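{- Let $q=4$ or $q\ge 7$ be a prime power, and let $\rho\ge 0$ be an integer. Let $S_\rho\subset\mathrm{PG}(2\rho+1,q)$ be the $((\rho+1)q+1)$-set defined below. Then: (i) $S_\rho$ is a minimal $\rho$-saturating set in $\mathrm{PG}(2\rho+1,q)$. (ii) Let $N_\rho$ be the set of points of $\mathrm{PG}(2\rho+1,q)$ that are not $\rho$-covered by $S_\rho\setminus\{e_{2\rho+1}\}$. Then $N_0=M_0$, $N_1=M_1$, and for $\rho\ge 2$, $N_\rho$ is a proper subset of $M_\rho$, where the sets $M_\rho$ are defined below. (iii) The $(\rho+1)q$-set $S_\rho\setminus\{e_{2\rho+1}\}$ is $(\rho+1)$-saturating in $\mathrm{PG}(2\rho+1,q)$.
   Context: Points of $\mathrm{PG}(2\rho+1,q)$ are written in homogeneous coordinates $(x_0,x_1,\dots,x_{2\rho+1})$, $x_i\in\mathbb{F}_q$; $e_0,\dots,e_{2\rho+1}$ denote the standard unit vectors (as points). The set $S_\rho$ is \[ S_\rho=\{e_0\}\cup\{e_0+ae_1: a\in\mathbb{F}_q^*\}\cup\bigcup_{u=1}^{\rho}\Big(\{e_{2u-1}+ae_{2u}+a^2e_{2u+1}: a\in\mathbb{F}_q^*\}\cup\{e_{2u}\}\Big)\cup\{e_{2\rho+1}\}, \] which has $(\rho+1)q+1$ points (for $\rho=0$ it is all of $\mathrm{PG}(1,q)$). A point set $S\subseteq\mathrm{PG}(N,q)$ is $\rho$-saturating if every point of $\mathrm{PG}(N,q)$ is a linear combination of at most $\rho+1$ points of $S$, and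 $\rho$ is the smallest value with this property; it is minimal if it contains no smaller $\rho$-saturating set. A point $A$ is $\rho$-covered by a set $S$ if $A$ is a linear combination of at most $\rho+1$ points of $S$. Define sets of vectors: $M_0=\{(x_0,x_1)\in\mathbb{F}_q^2: x_0=0,\ x_1\neq 0\}$, and for $\rho\ge1$, $M_\rho=\{(x_0,\dots,x_{2\rho+1})\in\mathbb{F}_q^{2\rho+2}: (x_0,\dots,x_{2\rho-1})\notin M_{\rho-1},\ x_{2\rho}=0,\ x_{2\rho+1}\ne 0\}$; a point is said to belong to $M_\rho$ if its coordinate vectors do. -}

module Defs where

open import Level using (Level; _⊔_)
open import Data.Nat using (ℕ; zero; suc; _≤_)
import Data.Nat as N
open import Data.Fin using (Fin; toℕ)
import Data.Fin as Fin
open import Data.Product using (Σ; ∃; _×_; _,_)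
open import Data.Sum using (_⊎_)
open import Relation.Nullary using (¬_)
open import Relation.Binary.PropositionalEquality as ≡ using (_≡_)
open import Function.Bundles using (Inverse)
open import Algebra.Bundles using (CommutativeRing)
open import Relation.Nullary.Decidable using (does)
open import Data.Bool using (if_then_else_)

IsField : ∀ {c ℓ} → CommutativeRing c ℓ → Set (c ⊔ ℓ)
IsField R = ¬ (0# ≈ 1#) × (∀ x → ¬ (x ≈ 0#) → ∃ λ y → (x * y) ≈ 1#)
  where open CommutativeRing R

HasCard : ∀ {c ℓ} → CommutativeRing c ℓ → ℕ → Set (c ⊔ ℓ)
HasCard R q = Inverse (CommutativeRing.setoid R) (≡.setoid (Fin q))

module Geometry {c ℓ} (R : CommutativeRing c ℓ) where
  open CommutativeRing R renaming (Carrier to F)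

  -- vectors of F^n; a point of PG(n-1,q) is represented by a nonzero vector
  Vect : ℕ → Set c
  Vect n = Fin n → F

  _≈ᵥ_ : ∀ {n} → Vect n → Vect n → Set ℓ
  v ≈ᵥ w = ∀ j → v j ≈ w j

  NonZeroV : ∀ {n} → Vect n → Set ℓ
  NonZeroV v = ∃ λ j → ¬ (v j ≈ 0#)

  zeroV : ∀ {n} → Vect n
  zeroV _ = 0#

  _+ᵥ_ : ∀ {n} → Vect n → Vect n → Vect n
  (v +ᵥ w) j = v j + w j

  _·ᵥ_ : ∀ {n} → F → Vect n → Vect n
  (a ·ᵥ v) j = a * v j

  -- standard unit vector e_k (indexed by a natural number; zero vector if k ≥ n,
  -- which never happens in uses below)
  e : ∀ {n} → ℕ → Vect n
  e k j = if does (toℕ j N.≟ k) then 1# else 0#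

  -- coordinate x_k of a vector (0 if k ≥ n)
  coord : ∀ {n} → Vect n → ℕ → F
  coord {zero} v k = 0#
  coord {suc n} v zero = v Fin.zero
  coord {suc n} v (suc k) = coord {n} (λ j → v (Fin.suc j)) k

  lincomb : ∀ {n} (k : ℕ) → (Fin k → F) → (Fin k → Vect n) → Vect n
  lincomb zero cs ps = zeroV
  lincomb (suc k) cs ps =
    (cs Fin.zero ·ᵥ ps Fin.zero) +ᵥ lincomb k (λ i → cs (Fin.suc i)) (λ i → ps (Fin.suc i))

  -- point sets are predicates on vectors (representatives)
  PointSet : ℕ → Set (Level.suc (c ⊔ ℓ))
  PointSet n = Vect n → Set (c ⊔ ℓ)

  CombOfAtMost : ∀ {n} → ℕ → PointSet n → Vect n → Set (c ⊔ ℓ)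
  CombOfAtMost {n} m S A =
    ∃ λ (k : ℕ) → k ≤ m × Σ (Fin k → F) λ cs → Σ (Fin k → Vect n) λ ps →
      (∀ i → S (ps i)) × (A ≈ᵥ lincomb k cs ps)

  Covered : ∀ {n} → ℕ → PointSet n → Vect n → Set (c ⊔ ℓ)
  Covered ρ S A = CombOfAtMost (suc ρ) S A

  AllCombOfAtMost : ∀ {n} → ℕ → PointSet n → Set (c ⊔ ℓ)
  AllCombOfAtMost {n} m S = ∀ (A : Vect n) → NonZeroV A → CombOfAtMost m S A

  Saturating : ∀ {n} → ℕ → PointSet n → Set (c ⊔ ℓ)
  Saturating ρ S = AllCombOfAtMost (suc ρ) S × ¬ AllCombOfAtMost ρ S

  -- T is a proper subset of S (as sets of points): T ⊆ S and some point of S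
  -- has no representative in T
  Proportional : ∀ {n} → Vect n → Vect n → Set (c ⊔ ℓ)
  Proportional v w = ∃ λ a → w ≈ᵥ (a ·ᵥ v)

  _⊂ₚ_ : ∀ {n} → PointSet n → PointSet n → Set (c ⊔ ℓ)
  T ⊂ₚ S = (∀ v → T v → S v) × (∃ λ v → S v × NonZeroV v × (∀ w → T w → ¬ Proportional v w))

  MinimalSaturating : ∀ {n} → ℕ → PointSet n → Set (Level.suc (c ⊔ ℓ))
  MinimalSaturating {n} ρ S = Saturating ρ S × (∀ (T : PointSet n) → T ⊂ₚ S → ¬ Saturating ρ T)

  NonZeroF : F → Set ℓ
  NonZeroF a = ¬ (a ≈ 0#)

  Sρ : (ρ : ℕ) → PointSet (2 N.* ρ N.+ 2)
  Sρ ρ v =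
      (v ≈ᵥ e 0)
    ⊎ (∃ λ a → NonZeroF a × (v ≈ᵥ (e 0 +ᵥ (a ·ᵥ e 1))))
    ⊎ (∃ λ u → 1 ≤ u × u ≤ ρ × ∃ λ a → NonZeroF a ×
         (v ≈ᵥ ((e (2 N.* u N.∸ 1) +ᵥ (a ·ᵥ e (2 N.* u))) +ᵥ ((a * a) ·ᵥ e (2 N.* u N.+ 1)))))
    ⊎ (∃ λ u → 1 ≤ u × u ≤ ρ × (v ≈ᵥ e (2 N.* u)))
    ⊎ (v ≈ᵥ e (2 N.* ρ N.+ 1))

  Sρ⁻ : (ρ : ℕ) → PointSet (2 N.* ρ N.+ 2)
  Sρ⁻ ρ v = Sρ ρ v × ¬ (v ≈ᵥ e (2 N.* ρ N.+ 1))

  Nρ : (ρ : ℕ) → PointSet (2 N.* ρ N.+ 2)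
  Nρ ρ v = NonZeroV v × ¬ Covered ρ (Sρ⁻ ρ) v

  Mseq : ℕ → (ℕ → F) → Set ℓ
  Mseq zero x = (x 0 ≈ 0#) × ¬ (x 1 ≈ 0#)
  Mseq (suc r) x = ¬ Mseq r x × (x (2 N.* r N.+ 2) ≈ 0#) × ¬ (x (2 N.* r N.+ 3) ≈ 0#)

  Mρ : (ρ : ℕ) → PointSet (2 N.* ρ N.+ 2)
  Mρ ρ v = Level.Lift (c ⊔ ℓ) (Mseq ρ (coord v))

  _≐ₚ_ : ∀ {n} → PointSet n → PointSet n → Set (c ⊔ ℓ)
  _≐ₚ_ {n} A B = ∀ (v : Vect n) → NonZeroV v → (A v → B v) × (B v → A v)

  _⊊ₚ_ : ∀ {n} → PointSet n → PointSet n → Set (c ⊔ ℓ)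
  _⊊ₚ_ {n} A B = (∀ (v : Vect n) → NonZeroV v → A v → B v)
               × (∃ λ (v : Vect n) → NonZeroV v × B v × ¬ A v)

module Submission where

-- Coordinates are grouped into blocks: block 0 is (x₀,x₁), block u ≥ 1 is
-- (x_{2u},x_{2u+1}).  Every point of S_ρ lies in one block; only
-- Q_u(a) = e_{2u-1} + a e_{2u} + a² e_{2u+1} also touches block u-1.
--
-- A vector is covered block by
-- block, by induction: the top block (y,z) is produced by a "move" of at most
-- three points Q_u(a), e_{2u}, whose side effect s on coordinate 2u-1 is then
-- absorbed by covering x - s e_{2u-1} on the lower blocks.  The moves need a
-- field with at least four elements in which every element is a square or
-- q ≥ 7 (LargeField); this is where q = 4 or q ≥ 7 enters.
--
-- A
-- combination of points of S_ρ is decomposed coordinatewise; a nonzero x_{2b}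
-- forces a point in block b, and x_{2ρ} = 0 ≠ x_{2ρ+1} forces two points in
-- block ρ unless e_{2ρ+1} is used.  Pigeonhole on blocks then bounds the
-- number of points, and a rigidity argument shows that each point of S_ρ is
-- indispensable.

open import Level using (_⊔_; Lift; lift)
open import Algebra.Bundles using (CommutativeRing)
open import Data.Nat as N using (ℕ; zero; suc; z≤n; s≤s)
import Data.Nat.Properties as NP
open import Data.Fin as Fin using (Fin; toℕ; fromℕ<)
import Data.Fin.Properties as FP
open import Data.Product using (Σ; ∃; _×_; _,_; proj₁; proj₂)
open import Data.Sum using (_⊎_; inj₁; inj₂; [_,_]′)
open import Data.Empty using (⊥; ⊥-elim)
open import Data.Unit using (⊤; tt)
open import Data.Bool using (if_then_else_)
open import Data.List using (List; []; _∷_; _++_; length; lookup)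
open import Data.List.Properties using (length-++)
open import Data.List.Relation.Unary.All as All using (All; []; _∷_)
import Data.List.Relation.Unary.All.Properties as AllP
open import Data.List.Relation.Unary.AllPairs using (AllPairs; []; _∷_)
open import Data.List.Membership.Propositional.Properties using (∈-lookup)
open import Relation.Nullary using (¬_; Dec; yes; no; does)
open import Relation.Nullary.Decidable using (dec-true; dec-false; _×-dec_; ¬?)
open import Relation.Binary.PropositionalEquality as P using (_≡_; _≢_)
open import Function.Bundles using (Inverse)
open import Defs

-- The canonical ring morphism ℤ → R, used to instantiate the standard library's
-- ring solver with integer coefficients on an arbitrary commutative ring, so
-- that polynomial identities in R are checked by normalisation.
module IntegerSolver {c ℓ} (R : CommutativeRing c ℓ) where
  open import Data.Integer as Z using (ℤ; +_; -[1+_]; _⊖_; _◃_; sign; ∣_∣)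
  import Data.Integer.Properties as ZP
  open import Data.Sign as Sg using (Sign)
  open import Data.Maybe using (Maybe; just; nothing)
  open import Algebra.Solver.Ring.AlmostCommutativeRing
  open CommutativeRing R
  open import Algebra.Properties.Ring ring using (-1*x≈-x; -‿involutive; -0#≈0#; -‿+-comm)
  open import Relation.Binary.Reasoning.Setoid setoid

  -- n ↦ 1 + ⋯ + 1, defined so that 1 ↦ 1# on the nose
  natF : ℕ → Carrier
  natF zero = 0#
  natF (suc zero) = 1#
  natF (suc (suc n)) = 1# + natF (suc n)

  natF-suc : ∀ n → natF (suc n) ≈ 1# + natF n
  natF-suc zero = sym (+-identityʳ _)
  natF-suc (suc n) = refl

  natF-+ : ∀ m n → natF (m N.+ n) ≈ natF m + natF n
  natF-+ zero n = sym (+-identityˡ _)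
  natF-+ (suc m) n = begin
    natF (suc (m N.+ n)) ≈⟨ natF-suc (m N.+ n) ⟩
    1# + natF (m N.+ n)  ≈⟨ +-congˡ (natF-+ m n) ⟩
    1# + (natF m + natF n) ≈⟨ sym (+-assoc _ _ _) ⟩
    (1# + natF m) + natF n ≈⟨ +-congʳ (sym (natF-suc m)) ⟩
    natF (suc m) + natF n ∎

  natF-* : ∀ m n → natF (m N.* n) ≈ natF m * natF n
  natF-* zero n = sym (zeroˡ _)
  natF-* (suc m) n = begin
    natF (n N.+ m N.* n) ≈⟨ natF-+ n (m N.* n) ⟩
    natF n + natF (m N.* n) ≈⟨ +-cong (sym (*-identityˡ _)) (natF-* m n) ⟩
    1# * natF n + natF m * natF n ≈⟨ sym (distribʳ _ _ _) ⟩
    (1# + natF m) * natF n ≈⟨ *-congʳ (sym (natF-suc m)) ⟩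
    natF (suc m) * natF n ∎

  ⟦_⟧ℤ : ℤ → Carrier
  ⟦ + n ⟧ℤ = natF n
  ⟦ -[1+ n ] ⟧ℤ = - natF (suc n)

  cancel-1 : ∀ a b → (1# + a) - (1# + b) ≈ a - b
  cancel-1 a b = begin
    (1# + a) + - (1# + b) ≈⟨ +-congˡ (sym (-‿+-comm 1# b)) ⟩
    (1# + a) + (- 1# + - b) ≈⟨ +-assoc _ _ _ ⟩
    1# + (a + (- 1# + - b)) ≈⟨ +-congˡ (sym (+-assoc _ _ _)) ⟩
    1# + ((a + - 1#) + - b) ≈⟨ +-congˡ (+-congʳ (+-comm _ _)) ⟩
    1# + ((- 1# + a) + - b) ≈⟨ +-congˡ (+-assoc _ _ _) ⟩
    1# + (- 1# + (a + - b)) ≈⟨ sym (+-assoc _ _ _) ⟩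
    (1# + - 1#) + (a + - b) ≈⟨ +-congʳ (-‿inverseʳ 1#) ⟩
    0# + (a + - b) ≈⟨ +-identityˡ _ ⟩
    a - b ∎

  ⊖-hom : ∀ m n → ⟦ m ⊖ n ⟧ℤ ≈ natF m - natF n
  ⊖-hom m zero = sym (trans (+-congˡ -0#≈0#) (+-identityʳ _))
  ⊖-hom zero (suc n) = sym (+-identityˡ _)
  ⊖-hom (suc m) (suc n) = begin
    ⟦ suc m ⊖ suc n ⟧ℤ ≈⟨ reflexive (P.cong ⟦_⟧ℤ (ZP.[1+m]⊖[1+n]≡m⊖n m n)) ⟩
    ⟦ m ⊖ n ⟧ℤ ≈⟨ ⊖-hom m n ⟩
    natF m - natF n ≈⟨ sym (cancel-1 _ _) ⟩
    (1# + natF m) - (1# + natF n) ≈⟨ +-cong (sym (natF-suc m)) (-‿cong (sym (natF-suc n))) ⟩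
    natF (suc m) - natF (suc n) ∎

  +-hom : ∀ i j → ⟦ i Z.+ j ⟧ℤ ≈ ⟦ i ⟧ℤ + ⟦ j ⟧ℤ
  +-hom (+ m) (+ n) = natF-+ m n
  +-hom (+ m) -[1+ n ] = ⊖-hom m (suc n)
  +-hom -[1+ m ] (+ n) = trans (⊖-hom n (suc m)) (+-comm _ _)
  +-hom -[1+ m ] -[1+ n ] = begin
    - natF (suc (suc (m N.+ n))) ≈⟨ -‿cong (reflexive (P.cong natF (P.cong suc (P.sym (NP.+-suc m n))))) ⟩
    - natF (suc m N.+ suc n) ≈⟨ -‿cong (natF-+ (suc m) (suc n)) ⟩
    - (natF (suc m) + natF (suc n)) ≈⟨ sym (-‿+-comm _ _) ⟩
    - natF (suc m) + - natF (suc n) ∎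

  sgn : Sign → Carrier
  sgn Sg.+ = 1#
  sgn Sg.- = - 1#

  ◃-hom : ∀ s n → ⟦ s ◃ n ⟧ℤ ≈ sgn s * natF n
  ◃-hom s zero = sym (zeroʳ _)
  ◃-hom Sg.+ (suc n) = sym (*-identityˡ _)
  ◃-hom Sg.- (suc n) = sym (-1*x≈-x _)

  ⟦⟧-sgn : ∀ i → ⟦ i ⟧ℤ ≈ sgn (sign i) * natF ∣ i ∣
  ⟦⟧-sgn (+ n) = sym (*-identityˡ _)
  ⟦⟧-sgn -[1+ n ] = sym (-1*x≈-x _)

  sgn-* : ∀ s t → sgn (s Sg.* t) ≈ sgn s * sgn t
  sgn-* Sg.+ t = sym (*-identityˡ _)
  sgn-* Sg.- Sg.+ = sym (*-identityʳ _)
  sgn-* Sg.- Sg.- = sym (trans (-1*x≈-x _) (-‿involutive _))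

  *-interchange : ∀ a b x y → (a * b) * (x * y) ≈ (a * x) * (b * y)
  *-interchange a b x y = begin
    (a * b) * (x * y) ≈⟨ *-assoc _ _ _ ⟩
    a * (b * (x * y)) ≈⟨ *-congˡ (sym (*-assoc _ _ _)) ⟩
    a * ((b * x) * y) ≈⟨ *-congˡ (*-congʳ (*-comm _ _)) ⟩
    a * ((x * b) * y) ≈⟨ *-congˡ (*-assoc _ _ _) ⟩
    a * (x * (b * y)) ≈⟨ sym (*-assoc _ _ _) ⟩
    (a * x) * (b * y) ∎

  *-hom : ∀ i j → ⟦ i Z.* j ⟧ℤ ≈ ⟦ i ⟧ℤ * ⟦ j ⟧ℤ
  *-hom i j = begin
    ⟦ (sign i Sg.* sign j) ◃ (∣ i ∣ N.* ∣ j ∣) ⟧ℤ ≈⟨ ◃-hom (sign i Sg.* sign j) (∣ i ∣ N.* ∣ j ∣) ⟩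
    sgn (sign i Sg.* sign j) * natF (∣ i ∣ N.* ∣ j ∣) ≈⟨ *-cong (sgn-* (sign i) (sign j)) (natF-* ∣ i ∣ ∣ j ∣) ⟩
    (sgn (sign i) * sgn (sign j)) * (natF ∣ i ∣ * natF ∣ j ∣) ≈⟨ *-interchange _ _ _ _ ⟩
    (sgn (sign i) * natF ∣ i ∣) * (sgn (sign j) * natF ∣ j ∣) ≈⟨ sym (*-cong (⟦⟧-sgn i) (⟦⟧-sgn j)) ⟩
    ⟦ i ⟧ℤ * ⟦ j ⟧ℤ ∎

  neg-hom : ∀ i → ⟦ Z.- i ⟧ℤ ≈ - ⟦ i ⟧ℤ
  neg-hom (+ zero) = sym -0#≈0#
  neg-hom (+ suc n) = refl
  neg-hom -[1+ n ] = sym (-‿involutive _)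

  ℤ-morphism : Z.+-*-rawRing -Raw-AlmostCommutative⟶ fromCommutativeRing R
  ℤ-morphism = record
    { ⟦_⟧ = ⟦_⟧ℤ ; +-homo = +-hom ; *-homo = *-hom ; -‿homo = neg-hom
    ; 0-homo = refl ; 1-homo = refl }

  ℤ-equal? : ∀ i j → Maybe (⟦ i ⟧ℤ ≈ ⟦ j ⟧ℤ)
  ℤ-equal? i j with i Z.≟ j
  ... | yes P.refl = just refl
  ... | no _ = nothing

  open import Algebra.Solver.Ring Z.+-*-rawRing (fromCommutativeRing R) ℤ-morphism ℤ-equal? public

  :0 :1 : ∀ {n} → Polynomial n
  :0 = con (+ 0)
  :1 = con (+ 1)

module FieldAlgebra {c ℓ} (R : CommutativeRing c ℓ) (isF : IsField R)
         (_≟_ : (x y : CommutativeRing.Carrier R) → Dec (CommutativeRing._≈_ R x y)) where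
  open CommutativeRing R renaming (Carrier to F) public
  open IntegerSolver R using (solve; _:+_; _:*_; :-_; _:-_; _:=_; :0; :1) public
  open import Relation.Binary.Reasoning.Setoid setoid public
  open import Algebra.Properties.Ring ring using (-0#≈0#) public

  infixl 7 _/_

  1≉0 : ¬ (1# ≈ 0#)
  1≉0 p = proj₁ isF (sym p)

  -- the inverse of x ≠ 0 (and, arbitrarily, 0 for x = 0)
  inv : F → F
  inv x with x ≟ 0#
  ... | yes _ = 0#
  ... | no p = proj₁ (proj₂ isF x p)

  inv-r : ∀ {x} → ¬ (x ≈ 0#) → x * inv x ≈ 1#
  inv-r {x} p with x ≟ 0#
  ... | yes q = ⊥-elim (p q)
  ... | no q = proj₂ (proj₂ isF x q)

  _/_ : F → F → F
  x / y = x * inv y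

  div-mul : ∀ x {y} → ¬ (y ≈ 0#) → (x / y) * y ≈ x
  div-mul x {y} p = begin
    (x * inv y) * y ≈⟨ *-assoc _ _ _ ⟩
    x * (inv y * y) ≈⟨ *-congˡ (*-comm _ _) ⟩
    x * (y * inv y) ≈⟨ *-congˡ (inv-r p) ⟩
    x * 1# ≈⟨ *-identityʳ _ ⟩
    x ∎

  mul-div : ∀ x {y} → ¬ (y ≈ 0#) → y * (x / y) ≈ x
  mul-div x p = trans (*-comm _ _) (div-mul x p)

  mul-div-cancel : ∀ x {y} → ¬ (y ≈ 0#) → (x * y) / y ≈ x
  mul-div-cancel x {y} p = begin
    (x * y) * inv y ≈⟨ *-assoc x y (inv y) ⟩
    x * (y * inv y) ≈⟨ *-congˡ (inv-r p) ⟩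
    x * 1# ≈⟨ *-identityʳ x ⟩
    x ∎

  cancelˡ : ∀ {c x y} → ¬ (c ≈ 0#) → c * x ≈ c * y → x ≈ y
  cancelˡ {c} {x} {y} p e = begin
    x ≈⟨ sym (mul-div-cancel x p) ⟩
    (x * c) / c ≈⟨ *-congʳ (trans (*-comm x c) (trans e (*-comm c y))) ⟩
    (y * c) / c ≈⟨ mul-div-cancel y p ⟩
    y ∎

  cancelʳ : ∀ {c x y} → ¬ (c ≈ 0#) → x * c ≈ y * c → x ≈ y
  cancelʳ p e = cancelˡ p (trans (*-comm _ _) (trans e (*-comm _ _)))

  nz-* : ∀ {a b} → ¬ (a ≈ 0#) → ¬ (b ≈ 0#) → ¬ (a * b ≈ 0#)
  nz-* {a} {b} pa pb e = pb (cancelˡ pa (trans e (sym (zeroʳ a))))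

  zero-prod : ∀ {a b} → a * b ≈ 0# → a ≈ 0# ⊎ b ≈ 0#
  zero-prod {a} {b} e with a ≟ 0# | b ≟ 0#
  ... | yes p | _ = inj₁ p
  ... | no _ | yes p = inj₂ p
  ... | no p | no q = ⊥-elim (nz-* p q e)

  nz-factor : ∀ {a b} → ¬ (a ≈ 0#) → a * b ≈ 0# → b ≈ 0#
  nz-factor a0 e = [ (λ a≈0 → ⊥-elim (a0 a≈0)) , (λ b≈0 → b≈0) ]′ (zero-prod e)

  nz-inv : ∀ {a} → ¬ (a ≈ 0#) → ¬ (inv a ≈ 0#)
  nz-inv {a} p e = 1≉0 (trans (sym (inv-r p)) (trans (*-congˡ e) (zeroʳ a)))

  nz-/ : ∀ {a b} → ¬ (a ≈ 0#) → ¬ (b ≈ 0#) → ¬ (a / b ≈ 0#)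
  nz-/ pa pb = nz-* pa (nz-inv pb)

  neg-involutive : ∀ a → a ≈ - (- a)
  neg-involutive = solve 1 (λ a → a := :- (:- a)) refl

  nz-neg : ∀ {a} → ¬ (a ≈ 0#) → ¬ (- a ≈ 0#)
  nz-neg {a} p e = p (trans (neg-involutive a) (trans (-‿cong e) -0#≈0#))

  diff0 : ∀ {a b} → a - b ≈ 0# → a ≈ b
  diff0 {a} {b} e = begin
    a ≈⟨ solve 2 (λ a b → a := (a :- b) :+ b) refl a b ⟩
    (a - b) + b ≈⟨ +-congʳ e ⟩
    0# + b ≈⟨ +-identityˡ b ⟩
    b ∎

  to-diff0 : ∀ {a b} → a ≈ b → a - b ≈ 0#
  to-diff0 {a} {b} e = trans (+-congʳ e) (-‿inverseʳ b)

  sum0⇒neg : ∀ {t y} → t + y ≈ 0# → t ≈ - y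
  sum0⇒neg {t} {y} e = begin
    t ≈⟨ solve 2 (λ t y → t := (t :+ y) :- y) refl t y ⟩
    (t + y) - y ≈⟨ +-congʳ e ⟩
    0# - y ≈⟨ +-identityˡ _ ⟩
    - y ∎

  sq-eq : ∀ {x y} → x * x ≈ y * y → x ≈ y ⊎ x ≈ - y
  sq-eq {x} {y} e with zero-prod {x - y} {x + y} (trans (solve 2 (λ x y → (x :- y) :* (x :+ y) := x :* x :- y :* y) refl x y) (to-diff0 e))
  ... | inj₁ p = inj₁ (diff0 p)
  ... | inj₂ p = inj₂ (diff0 (trans (solve 2 (λ x y → x :- (:- y) := x :+ y) refl x y) p))

  two*a : ∀ a → a + a ≈ (1# + 1#) * a
  two*a = solve 1 (λ a → a :+ a := (:1 :+ :1) :* a) refl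

module FiniteRing {c ℓ} (R : CommutativeRing c ℓ) (q : ℕ) (card : HasCard R q) where
  open CommutativeRing R renaming (Carrier to F)
  open Inverse card

  _≟_ : (x y : F) → Dec (x ≈ y)
  x ≟ y with to x Fin.≟ to y
  ... | yes e = yes (trans (sym (strictlyInverseʳ x)) (trans (from-cong e) (strictlyInverseʳ y)))
  ... | no ne = no λ e → ne (to-cong e)

  from-injective : ∀ {i j} → from i ≈ from j → i ≡ j
  from-injective {i} {j} e = P.trans (P.sym (strictlyInverseˡ i)) (P.trans (to-cong e) (strictlyInverseˡ j))

  Occurs : F → List F → Set ℓ
  Occurs a L = Σ (Fin (length L)) λ k → a ≈ lookup L k

  avoid-all : ∀ a L → ¬ Occurs a L → All (λ l → ¬ (a ≈ l)) L
  avoid-all a [] _ = []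
  avoid-all a (l ∷ L) ni = (λ e → ni (Fin.zero , e)) ∷ avoid-all a L (λ { (k , e) → ni (Fin.suc k , e) })

  avoid : (L : List F) → length L N.< q → Σ F λ a → All (λ l → ¬ (a ≈ l)) L
  avoid L lt with FP.all? {P = λ i → Occurs (from i) L} (λ i → FP.any? (λ k → from i ≟ lookup L k))
  ... | no nall with FP.¬∀⟶∃¬ q (λ i → Occurs (from i) L) (λ i → FP.any? (λ k → from i ≟ lookup L k)) nall
  ...   | i , ni = from i , avoid-all (from i) L ni
  avoid L lt | yes all with FP.pigeonhole lt (λ i → proj₁ (all i))
  ... | i , j , i<j , eq = ⊥-elim (FP.<⇒≢ i<j (from-injective (trans (proj₂ (all i))
          (trans (reflexive (P.cong (lookup L) eq)) (sym (proj₂ (all j)))))))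

  square? : ∀ w → Dec (∃ λ a → a * a ≈ w)
  square? w with FP.any? {P = λ i → from i * from i ≈ w} (λ i → (from i * from i) ≟ w)
  ... | yes (i , p) = yes (from i , p)
  ... | no np = no λ { (a , p) → np (to a , trans (*-cong (strictlyInverseʳ a) (strictlyInverseʳ a)) p) }

  Distinct : List F → Set (c ⊔ ℓ)
  Distinct = AllPairs (λ a b → ¬ (a ≈ b))

  lookup-injective : ∀ (L : List F) → Distinct L → ∀ i j → lookup L i ≈ lookup L j → i ≡ j
  lookup-injective (x ∷ L) (h ∷ t) Fin.zero Fin.zero e = P.refl
  lookup-injective (x ∷ L) (h ∷ t) Fin.zero (Fin.suc j) e = ⊥-elim (All.lookup h (∈-lookup j) e)
  lookup-injective (x ∷ L) (h ∷ t) (Fin.suc i) Fin.zero e = ⊥-elim (All.lookup h (∈-lookup i) (sym e))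
  lookup-injective (x ∷ L) (h ∷ t) (Fin.suc i) (Fin.suc j) e = P.cong Fin.suc (lookup-injective L t i j e)

  distinct≤q : ∀ (L : List F) → Distinct L → length L N.≤ q
  distinct≤q L ap with length L N.≤? q
  ... | yes p = p
  ... | no np with FP.pigeonhole (NP.≰⇒> np) (λ i → to (lookup L i))
  ...   | i , j , i<j , eq = ⊥-elim (FP.<⇒≢ i<j (lookup-injective L ap i j
            (trans (sym (strictlyInverseʳ _)) (trans (from-cong eq) (strictlyInverseʳ _)))))

  -- In the field with four elements 1 + 1 = 0 (otherwise 0, 1, -1, g, -g would
  -- be five distinct elements), so squaring is injective, hence surjective.
  module FourElements (isF : IsField R) (q≡4 : q ≡ 4) where
    open FieldAlgebra R isF _≟_ using (1≉0; nz-neg; zero-prod; sq-eq; sum0⇒neg; neg-involutive; two*a)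

    5≰q : ¬ (5 N.≤ q)
    5≰q le = NP.<-irrefl P.refl (P.subst (5 N.≤_) q≡4 le)

    characteristic2 : 1# + 1# ≈ 0#
    characteristic2 with (1# + 1#) ≟ 0#
    ... | yes p = p
    ... | no t0 with avoid (0# ∷ 1# ∷ - 1# ∷ []) (P.subst (3 N.<_) (P.sym q≡4) (NP.n<1+n 3))
    ...   | g , (g0 ∷ g1 ∷ gm1 ∷ []) = ⊥-elim (5≰q (distinct≤q (0# ∷ 1# ∷ - 1# ∷ g ∷ - g ∷ []) distinct))
      where
      m10 : ¬ (- 1# ≈ 0#)
      m10 = nz-neg 1≉0
      n1m1 : ¬ (1# ≈ - 1#)
      n1m1 e = t0 (trans (+-congʳ e) (-‿inverseˡ 1#))
      ng0 : ¬ (- g ≈ 0#)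
      ng0 = nz-neg g0
      ng1 : ¬ (1# ≈ - g)
      ng1 e = gm1 (trans (neg-involutive g) (-‿cong (sym e)))
      ngm1 : ¬ (- 1# ≈ - g)
      ngm1 e = g1 (trans (neg-involutive g) (trans (-‿cong (sym e)) (sym (neg-involutive 1#))))
      ngg : ¬ (g ≈ - g)
      ngg e = [ t0 , g0 ]′ (zero-prod (trans (sym (two*a g)) (trans (+-congˡ e) (-‿inverseʳ g))))
      distinct : Distinct (0# ∷ 1# ∷ - 1# ∷ g ∷ - g ∷ [])
      distinct = (proj₁ isF ∷ (λ e → m10 (sym e)) ∷ (λ e → g0 (sym e)) ∷ (λ e → ng0 (sym e)) ∷ [])
               ∷ (n1m1 ∷ (λ e → g1 (sym e)) ∷ ng1 ∷ [])
               ∷ ((λ e → gm1 (sym e)) ∷ ngm1 ∷ [])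
               ∷ (ngg ∷ [])
               ∷ [] ∷ []

    square-injective : ∀ {a b} → a * a ≈ b * b → a ≈ b
    square-injective {a} {b} e = [ (λ p → p) , (λ p → trans p (sym b≈-b)) ]′ (sq-eq e)
      where
      b≈-b : b ≈ - b
      b≈-b = sum0⇒neg (trans (two*a b) (trans (*-congʳ characteristic2) (zeroˡ b)))

    every-square : ∀ w → ∃ λ a → a * a ≈ w
    every-square w with square? w
    ... | yes p = p
    ... | no nw = ⊥-elim (5≰q (distinct≤q _ distinct))
      where
      elt : Fin 4 → F
      elt i = from (P.subst Fin (P.sym q≡4) i)
      sq : Fin 4 → F
      sq i = elt i * elt i
      elt-injective : ∀ {i j} → elt i ≈ elt j → i ≡ j
      elt-injective {i} {j} e = P.subst-injective (P.sym q≡4) (from-injective e)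
      w≉sq : ∀ i → ¬ (w ≈ sq i)
      w≉sq i e = nw (elt i , sym e)
      sq≉ : ∀ i j → i ≢ j → ¬ (sq i ≈ sq j)
      sq≉ i j ne e = ne (elt-injective (square-injective e))
      i0 i1 i2 i3 : Fin 4
      i0 = Fin.zero
      i1 = Fin.suc Fin.zero
      i2 = Fin.suc (Fin.suc Fin.zero)
      i3 = Fin.suc (Fin.suc (Fin.suc Fin.zero))
      distinct : Distinct (w ∷ sq i0 ∷ sq i1 ∷ sq i2 ∷ sq i3 ∷ [])
      distinct = (w≉sq i0 ∷ w≉sq i1 ∷ w≉sq i2 ∷ w≉sq i3 ∷ [])
               ∷ (sq≉ i0 i1 (λ ()) ∷ sq≉ i0 i2 (λ ()) ∷ sq≉ i0 i3 (λ ()) ∷ [])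
               ∷ (sq≉ i1 i2 (λ ()) ∷ sq≉ i1 i3 (λ ()) ∷ [])
               ∷ (sq≉ i2 i3 (λ ()) ∷ [])
               ∷ [] ∷ []

-- Index arithmetic: coordinate 2u is the even and 2u+1 the odd entry of block u.
module Parity where
  odd-eq : ∀ u → 2 N.* u N.+ 1 ≡ suc (2 N.* u)
  odd-eq u = NP.+-comm (2 N.* u) 1

  pred-eq : ∀ w → 2 N.* suc w N.∸ 1 ≡ suc (2 N.* w)
  pred-eq w = NP.+-suc w (w N.+ 0)

  dbl-suc : ∀ w → 2 N.* suc w ≡ suc (suc (2 N.* w))
  dbl-suc w = P.cong suc (NP.+-suc w (w N.+ 0))

  dbl-inj : ∀ {a b} → 2 N.* a ≡ 2 N.* b → a ≡ b
  dbl-inj {a} {b} e = NP.*-cancelˡ-≡ a b 2 e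

  dim-eq : ∀ ρ → 2 N.* ρ N.+ 2 ≡ 2 N.* suc ρ
  dim-eq ρ = P.trans (NP.+-comm (2 N.* ρ) 2) (P.sym (dbl-suc ρ))

  odd-top-eq : ∀ r → 2 N.* r N.+ 3 ≡ suc (2 N.* suc r)
  odd-top-eq r = P.trans (NP.+-comm (2 N.* r) 3) (P.cong suc (P.sym (dbl-suc r)))

  odd<blocks : ∀ {w r} → w N.< r → suc (2 N.* suc w) N.< 2 N.* suc r
  odd<blocks {w} {r} p = P.subst (N._≤ 2 N.* suc r) (dbl-suc (suc w)) (NP.*-monoʳ-≤ 2 (s≤s p))

  split-last-two : ∀ {j K} → j N.< suc (suc K) → j N.< K ⊎ j ≡ K ⊎ j ≡ suc K
  split-last-two {j} {K} (s≤s p) with NP.m≤n⇒m<n∨m≡n p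
  ... | inj₂ e = inj₂ (inj₂ e)
  ... | inj₁ (s≤s p') with NP.m≤n⇒m<n∨m≡n p'
  ... | inj₁ q = inj₁ q
  ... | inj₂ e = inj₂ (inj₁ e)

module Descriptors {c ℓ} (R : CommutativeRing c ℓ) (isF : IsField R)
         (_≟_ : (x y : CommutativeRing.Carrier R) → Dec (CommutativeRing._≈_ R x y)) where
  open FieldAlgebra R isF _≟_
  open Parity

  ev : ℕ → ℕ → F
  ev k m = if does (m N.≟ k) then 1# else 0#

  ev-eq : ∀ k → ev k k ≡ 1#
  ev-eq k rewrite dec-true (k N.≟ k) P.refl = P.refl

  ev-neq : ∀ {k m} → m ≢ k → ev k m ≡ 0#
  ev-neq {k} {m} p rewrite dec-false (m N.≟ k) p = P.refl

  ev1 : ∀ k → ev k k ≈ 1#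
  ev1 k = reflexive (ev-eq k)

  ev0 : ∀ {k m} → m ≢ k → ev k m ≈ 0#
  ev0 p = reflexive (ev-neq p)

  ev0< : ∀ {k m} → m N.< k → ev k m ≈ 0#
  ev0< p = ev0 (NP.<⇒≢ p)

  ev0> : ∀ {k m} → k N.< m → ev k m ≈ 0#
  ev0> p = ev0 (λ e → NP.<⇒≢ p (P.sym e))

  ev-ee : ∀ u b → u ≢ b → ev (2 N.* u) (2 N.* b) ≈ 0#
  ev-ee u b p = ev0 (λ e → p (P.sym (dbl-inj e)))
  ev-eo : ∀ u b → ev (2 N.* u) (suc (2 N.* b)) ≈ 0#
  ev-eo u b = ev0 (λ e → NP.even≢odd u b (P.sym e))
  ev-oe : ∀ u b → ev (suc (2 N.* u)) (2 N.* b) ≈ 0#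
  ev-oe u b = ev0 (λ e → NP.even≢odd b u e)
  ev-oo : ∀ u b → u ≢ b → ev (suc (2 N.* u)) (suc (2 N.* b)) ≈ 0#
  ev-oo u b p = ev0 (λ e → p (P.sym (dbl-inj (NP.suc-injective e))))

  -- descriptors of points: P0 a = e₀ + a e₁, Q u a = e_{2u-1} + a e_{2u} + a² e_{2u+1},
  -- E u = e_{2u}, Top r = e_{2r+1}
  data D : Set c where
    P0 : F → D
    Q : ℕ → F → D
    E : ℕ → D
    Top : ℕ → D

  vecD : D → ℕ → F
  vecD (P0 a) j = ev 0 j + a * ev 1 j
  vecD (Q u a) j = (ev (2 N.* u N.∸ 1) j + a * ev (2 N.* u) j) + (a * a) * ev (2 N.* u N.+ 1) j
  vecD (E u) j = ev (2 N.* u) j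
  vecD (Top r) j = ev (2 N.* r N.+ 1) j

  -- Q_{w+1}(a) and e_{2r+1} with their indices in the form 2w+1, 2w+2, 2w+3
  vecQ : ∀ w a j → vecD (Q (suc w) a) j ≡ (ev (suc (2 N.* w)) j + a * ev (2 N.* suc w) j) + (a * a) * ev (suc (2 N.* suc w)) j
  vecQ w a j = P.cong₂ (λ i1 i3 → (ev i1 j + a * ev (2 N.* suc w) j) + (a * a) * ev i3 j) (pred-eq w) (odd-eq (suc w))

  vecTop : ∀ r j → vecD (Top r) j ≡ ev (suc (2 N.* r)) j
  vecTop r j = P.cong (λ i → ev i j) (odd-eq r)

  -- the block a point lives in (its even coordinate)
  block : D → ℕ
  block (P0 _) = 0
  block (Q u _) = u
  block (E u) = u
  block (Top r) = suc r

  -- Valid r d: d describes a point of S_r other than e_{2r+1}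
  data Valid (r : ℕ) : D → Set (c ⊔ ℓ) where
    vP0 : ∀ a → Valid r (P0 a)
    vQ : ∀ {w a} → w N.< r → ¬ (a ≈ 0#) → Valid r (Q (suc w) a)
    vE : ∀ {w} → w N.< r → Valid r (E (suc w))

  valid-suc : ∀ {r d} → Valid r d → Valid (suc r) d
  valid-suc (vP0 a) = vP0 a
  valid-suc (vQ p a) = vQ (NP.m≤n⇒m≤1+n p) a
  valid-suc (vE p) = vE (NP.m≤n⇒m≤1+n p)

  block≤ : ∀ {ρ d} → Valid ρ d → block d N.≤ ρ
  block≤ (vP0 a) = z≤n
  block≤ (vQ p _) = p
  block≤ (vE p) = p

  P0-first : ∀ a → vecD (P0 a) 0 ≈ 1#
  P0-first = solve 1 (λ a → :1 :+ a :* :0 := :1) refl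

  P0-second : ∀ a → vecD (P0 a) 1 ≈ a
  P0-second = solve 1 (λ a → :0 :+ a :* :1 := a) refl

  Q-side : ∀ w a → vecD (Q (suc w) a) (suc (2 N.* w)) ≈ 1#
  Q-side w a = begin
    vecD (Q (suc w) a) (suc (2 N.* w)) ≈⟨ reflexive (vecQ w a j) ⟩
    (ev (suc (2 N.* w)) j + a * ev (2 N.* suc w) j) + (a * a) * ev (suc (2 N.* suc w)) j
      ≈⟨ +-cong (+-cong (ev1 (suc (2 N.* w))) (*-congˡ (ev-eo (suc w) w))) (*-congˡ (ev-oo (suc w) w (λ e → NP.<⇒≢ (NP.n<1+n w) (P.sym e)))) ⟩
    (1# + a * 0#) + (a * a) * 0# ≈⟨ solve 1 (λ a → (:1 :+ a :* :0) :+ (a :* a) :* :0 := :1) refl a ⟩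
    1# ∎
    where j = suc (2 N.* w)
  Q-even : ∀ w a → vecD (Q (suc w) a) (2 N.* suc w) ≈ a
  Q-even w a = begin
    vecD (Q (suc w) a) (2 N.* suc w) ≈⟨ reflexive (vecQ w a j) ⟩
    (ev (suc (2 N.* w)) j + a * ev (2 N.* suc w) j) + (a * a) * ev (suc (2 N.* suc w)) j
      ≈⟨ +-cong (+-cong (ev-oe w (suc w)) (*-congˡ (ev1 (2 N.* suc w)))) (*-congˡ (ev-oe (suc w) (suc w))) ⟩
    (0# + a * 1#) + (a * a) * 0# ≈⟨ solve 1 (λ a → (:0 :+ a :* :1) :+ (a :* a) :* :0 := a) refl a ⟩
    a ∎
    where j = 2 N.* suc w
  Q-odd : ∀ w a → vecD (Q (suc w) a) (suc (2 N.* suc w)) ≈ a * a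
  Q-odd w a = begin
    vecD (Q (suc w) a) (suc (2 N.* suc w)) ≈⟨ reflexive (vecQ w a j) ⟩
    (ev (suc (2 N.* w)) j + a * ev (2 N.* suc w) j) + (a * a) * ev (suc (2 N.* suc w)) j
      ≈⟨ +-cong (+-cong (ev-oo w (suc w) (NP.<⇒≢ (NP.n<1+n w))) (*-congˡ (ev-eo (suc w) (suc w)))) (*-congˡ (ev1 (suc (2 N.* suc w)))) ⟩
    (0# + a * 0#) + (a * a) * 1# ≈⟨ solve 1 (λ a → (:0 :+ a :* :0) :+ (a :* a) :* :1 := a :* a) refl a ⟩
    a * a ∎
    where j = suc (2 N.* suc w)

  vanish : ∀ {r d j} → Valid r d → 2 N.* suc r N.≤ j → vecD d j ≈ 0#
  vanish {r} {P0 a} {j} (vP0 .a) le = begin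
    ev 0 j + a * ev 1 j ≈⟨ +-cong (ev0> (NP.<-≤-trans (s≤s z≤n) 2≤j)) (*-congˡ (ev0> 2≤j)) ⟩
    0# + a * 0# ≈⟨ solve 1 (λ a → :0 :+ a :* :0 := :0) refl a ⟩
    0# ∎
    where
    2≤j : 2 N.≤ j
    2≤j = NP.≤-trans (NP.*-monoʳ-≤ 2 (s≤s (z≤n {r}))) le
  vanish {r} {Q (suc w) a} {j} (vQ p nz) le = begin
    vecD (Q (suc w) a) j ≈⟨ reflexive (vecQ w a j) ⟩
    _ ≈⟨ +-cong (+-cong (ev0> i1) (*-congˡ (ev0> i2))) (*-congˡ (ev0> i3)) ⟩
    (0# + a * 0#) + (a * a) * 0# ≈⟨ solve 1 (λ a → (:0 :+ a :* :0) :+ (a :* a) :* :0 := :0) refl a ⟩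
    0# ∎
    where
    i3 : suc (2 N.* suc w) N.< j
    i3 = NP.<-≤-trans (odd<blocks p) le
    i2 : 2 N.* suc w N.< j
    i2 = NP.<-trans (NP.n<1+n _) i3
    i1 : suc (2 N.* w) N.< j
    i1 = NP.<-trans (P.subst (suc (2 N.* w) N.<_) (P.sym (dbl-suc w)) (NP.n<1+n _)) i2
  vanish {r} {E (suc w)} {j} (vE p) le = ev0> (NP.<-trans (NP.n<1+n _) (NP.<-≤-trans (odd<blocks p) le))

  Item : Set c
  Item = F × D

  comb : List Item → ℕ → F
  comb [] j = 0#
  comb ((a , d) ∷ l) j = a * vecD d j + comb l j

  comb-++ : ∀ l m j → comb (l ++ m) j ≈ comb l j + comb m j
  comb-++ [] m j = sym (+-identityˡ _)
  comb-++ ((a , d) ∷ l) m j = trans (+-congˡ (comb-++ l m j)) (sym (+-assoc _ _ _))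

  ValidItem : ℕ → Item → Set (c ⊔ ℓ)
  ValidItem r it = Valid r (proj₂ it)

  vanish-comb : ∀ {r l j} → All (ValidItem r) l → 2 N.* suc r N.≤ j → comb l j ≈ 0#
  vanish-comb [] le = refl
  vanish-comb {r} {(a , d) ∷ l} {j} (v ∷ vs) le = begin
    a * vecD d j + comb l j ≈⟨ +-cong (*-congˡ (vanish v le)) (vanish-comb vs le) ⟩
    a * 0# + 0# ≈⟨ solve 1 (λ a → a :* :0 :+ :0 := :0) refl a ⟩
    0# ∎

  Cover : ℕ → ℕ → (ℕ → F) → Set (c ⊔ ℓ)
  Cover r k x = Σ (List Item) λ l → (length l N.≤ k) × All (ValidItem r) l × (∀ j → j N.< 2 N.* suc r → x j ≈ comb l j)

  Cover-mono : ∀ {r k k' x} → k N.≤ k' → Cover r k x → Cover r k' x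
  Cover-mono le (l , a , b , e) = l , NP.≤-trans a le , b , e

  MoveSpec : ℕ → List Item → F → F → F → Set (c ⊔ ℓ)
  MoveSpec r m s y z = All (ValidItem (suc r)) m ×
    (∀ j → comb m j ≈ (s * ev (suc (2 N.* r)) j + y * ev (2 N.* suc r) j) + z * ev (suc (2 N.* suc r)) j)

  moveSpec-Q : ∀ r c a → ¬ (a ≈ 0#) → MoveSpec r ((c , Q (suc r) a) ∷ []) c (c * a) (c * (a * a))
  moveSpec-Q r c a nz = (vQ (NP.n<1+n r) nz ∷ []) , λ j → begin
    c * vecD (Q (suc r) a) j + 0# ≈⟨ +-congʳ (*-congˡ (reflexive (vecQ r a j))) ⟩
    c * ((ev (suc (2 N.* r)) j + a * ev (2 N.* suc r) j) + (a * a) * ev (suc (2 N.* suc r)) j) + 0#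
      ≈⟨ solve 5 (λ c a e1 e2 e3 → c :* ((e1 :+ a :* e2) :+ (a :* a) :* e3) :+ :0 := (c :* e1 :+ (c :* a) :* e2) :+ (c :* (a :* a)) :* e3) refl c a (ev (suc (2 N.* r)) j) (ev (2 N.* suc r) j) (ev (suc (2 N.* suc r)) j) ⟩
    (c * ev (suc (2 N.* r)) j + (c * a) * ev (2 N.* suc r) j) + (c * (a * a)) * ev (suc (2 N.* suc r)) j ∎

  moveSpec-E : ∀ r c → MoveSpec r ((c , E (suc r)) ∷ []) 0# c 0#
  moveSpec-E r c = (vE (NP.n<1+n r) ∷ []) , λ j →
    solve 4 (λ c e1 e2 e3 → c :* e2 :+ :0 := (:0 :* e1 :+ c :* e2) :+ :0 :* e3) refl c (ev (suc (2 N.* r)) j) (ev (2 N.* suc r) j) (ev (suc (2 N.* suc r)) j)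

  moveSpec-[] : ∀ r → MoveSpec r [] 0# 0# 0#
  moveSpec-[] r = [] , λ j → solve 3 (λ e1 e2 e3 → :0 := (:0 :* e1 :+ :0 :* e2) :+ :0 :* e3) refl (ev (suc (2 N.* r)) j) (ev (2 N.* suc r) j) (ev (suc (2 N.* suc r)) j)

  moveSpec-++ : ∀ {r m1 m2 s1 y1 z1 s2 y2 z2} → MoveSpec r m1 s1 y1 z1 → MoveSpec r m2 s2 y2 z2 →
                MoveSpec r (m1 ++ m2) (s1 + s2) (y1 + y2) (z1 + z2)
  moveSpec-++ {r} {m1} {m2} {s1} {y1} {z1} {s2} {y2} {z2} (v1 , e1) (v2 , e2) = AllP.++⁺ v1 v2 , λ j → begin
    comb (m1 ++ m2) j ≈⟨ comb-++ m1 m2 j ⟩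
    comb m1 j + comb m2 j ≈⟨ +-cong (e1 j) (e2 j) ⟩
    _ ≈⟨ solve 9 (λ s1 y1 z1 s2 y2 z2 a b d →
          ((s1 :* a :+ y1 :* b) :+ z1 :* d) :+ ((s2 :* a :+ y2 :* b) :+ z2 :* d)
          := ((s1 :+ s2) :* a :+ (y1 :+ y2) :* b) :+ (z1 :+ z2) :* d) refl s1 y1 z1 s2 y2 z2 (ev (suc (2 N.* r)) j) (ev (2 N.* suc r) j) (ev (suc (2 N.* suc r)) j) ⟩
    _ ∎

  moveSpec-≈ : ∀ {r m s y z s' y' z'} → s ≈ s' → y ≈ y' → z ≈ z' → MoveSpec r m s y z → MoveSpec r m s' y' z'
  moveSpec-≈ es ey ez (v , e) = v , λ j → trans (e j) (+-cong (+-cong (*-congʳ es) (*-congʳ ey)) (*-congʳ ez))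

  -- x with s e_{2r+1} removed: what the lower blocks must cover after a move with side effect s
  shift : (ℕ → F) → ℕ → F → ℕ → F
  shift x r s j = x j - s * ev (suc (2 N.* r)) j

  extend-cover : ∀ r {k} x s m → Cover r k (shift x r s) →
                 MoveSpec r m s (x (2 N.* suc r)) (x (suc (2 N.* suc r))) → Cover (suc r) (k N.+ length m) x
  extend-cover r {k} x s m (l , len , vl , cov) (vm , em) =
    l ++ m , len' , AllP.++⁺ (All.map valid-suc vl) vm , cov'
    where
    len' : length (l ++ m) N.≤ k N.+ length m
    len' = P.subst (N._≤ k N.+ length m) (P.sym (length-++ l)) (NP.+-monoˡ-≤ (length m) len)
    y = x (2 N.* suc r)
    z = x (suc (2 N.* suc r))
    cov' : ∀ j → j N.< 2 N.* suc (suc r) → x j ≈ comb (l ++ m) j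
    cov' j jlt with split-last-two (P.subst (j N.<_) (dbl-suc (suc r)) jlt)
    ... | inj₁ jl = sym (begin
      comb (l ++ m) j ≈⟨ comb-++ l m j ⟩
      comb l j + comb m j ≈⟨ +-cong (sym (cov j jl)) (em j) ⟩
      shift x r s j + ((s * ev (suc (2 N.* r)) j + y * ev (2 N.* suc r) j) + z * ev (suc (2 N.* suc r)) j)
        ≈⟨ +-congˡ (+-cong (+-congˡ (*-congˡ (ev0< jl))) (*-congˡ (ev0< (NP.<-trans jl (NP.n<1+n _))))) ⟩
      (x j - s * ev (suc (2 N.* r)) j) + ((s * ev (suc (2 N.* r)) j + y * 0#) + z * 0#)
        ≈⟨ solve 5 (λ xj s e y z → (xj :- s :* e) :+ ((s :* e :+ y :* :0) :+ z :* :0) := xj) refl (x j) s (ev (suc (2 N.* r)) j) y z ⟩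
      x j ∎)
    ... | inj₂ (inj₁ P.refl) = sym (begin
      comb (l ++ m) j ≈⟨ comb-++ l m j ⟩
      comb l j + comb m j ≈⟨ +-cong (vanish-comb vl NP.≤-refl) (em j) ⟩
      0# + ((s * ev (suc (2 N.* r)) j + y * ev (2 N.* suc r) j) + z * ev (suc (2 N.* suc r)) j)
        ≈⟨ +-congˡ (+-cong (+-cong (*-congˡ (ev-oe r (suc r))) (*-congˡ (ev1 (2 N.* suc r)))) (*-congˡ (ev-oe (suc r) (suc r)))) ⟩
      0# + ((s * 0# + y * 1#) + z * 0#) ≈⟨ solve 3 (λ s y z → :0 :+ ((s :* :0 :+ y :* :1) :+ z :* :0) := y) refl s y z ⟩
      y ∎)
    ... | inj₂ (inj₂ P.refl) = sym (begin
      comb (l ++ m) j ≈⟨ comb-++ l m j ⟩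
      comb l j + comb m j ≈⟨ +-cong (vanish-comb vl (NP.n≤1+n _)) (em j) ⟩
      0# + ((s * ev (suc (2 N.* r)) j + y * ev (2 N.* suc r) j) + z * ev (suc (2 N.* suc r)) j)
        ≈⟨ +-congˡ (+-cong (+-cong (*-congˡ (ev-oo r (suc r) (NP.<⇒≢ (NP.n<1+n r)))) (*-congˡ (ev-eo (suc r) (suc r)))) (*-congˡ (ev1 (2 N.* suc r)))) ⟩
      0# + ((s * 0# + y * 0#) + z * 1#) ≈⟨ solve 3 (λ s y z → :0 :+ ((s :* :0 :+ y :* :0) :+ z :* :1) := z) refl s y z ⟩
      z ∎)

record LargeField {c ℓ} (R : CommutativeRing c ℓ) (q : ℕ) : Set (c ⊔ ℓ) where
  open CommutativeRing R renaming (Carrier to F)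
  field
    avoid : (L : List F) → length L N.< q → Σ F λ a → All (λ l → ¬ (a ≈ l)) L
    4≤q : 4 N.≤ q
    square? : ∀ w → Dec (∃ λ a → a * a ≈ w)
    all-squares-or-7≤q : (∀ w → ∃ λ a → a * a ≈ w) ⊎ 7 N.≤ q

module MoveIdentities {c ℓ} (R : CommutativeRing c ℓ) where
  open CommutativeRing R
  open IntegerSolver R

  -- move-one: (y²/z)(z/y) = y and (y²/z)(z/y)² = z, with iy, iz the inverses
  one-point-even : ∀ y z iy iz → ((y * y) * iz) * (z * iy) ≈ y * ((y * iy) * (z * iz))
  one-point-even = solve 4 (λ y z iy iz → ((y :* y) :* iz) :* (z :* iy) := y :* ((y :* iy) :* (z :* iz))) refl
  one-point-odd : ∀ y z iy iz → ((y * y) * iz) * ((z * iy) * (z * iy)) ≈ z * ((y * iy) * ((y * iy) * (z * iz)))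
  one-point-odd = solve 4 (λ y z iy iz → ((y :* y) :* iz) :* ((z :* iy) :* (z :* iy)) := z :* ((y :* iy) :* ((y :* iy) :* (z :* iz)))) refl
  *-1·1 : ∀ y → y * (1# * 1#) ≈ y
  *-1·1 = solve 1 (λ y → y :* (:1 :* :1) := y) refl
  *-1·1·1 : ∀ y → y * (1# * (1# * 1#)) ≈ y
  *-1·1·1 = solve 1 (λ y → y :* (:1 :* (:1 :* :1)) := y) refl

  -- two-point-solution, after multiplying by k = a - b
  solution-sum : ∀ y s a b → (y - s * b) + (s * a - y) ≈ s * (a - b)
  solution-sum = solve 4 (λ y s a b → (y :- s :* b) :+ (s :* a :- y) := s :* (a :- b)) refl
  solution-even-expand : ∀ cc d a b k → (cc * a + d * b) * k ≈ a * (cc * k) + b * (d * k)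
  solution-even-expand = solve 5 (λ cc d a b k → (cc :* a :+ d :* b) :* k := a :* (cc :* k) :+ b :* (d :* k)) refl
  solution-even : ∀ y s a b → a * (y - s * b) + b * (s * a - y) ≈ y * (a - b)
  solution-even = solve 4 (λ y s a b → a :* (y :- s :* b) :+ b :* (s :* a :- y) := y :* (a :- b)) refl
  solution-odd-expand : ∀ cc d a b k → (cc * (a * a) + d * (b * b)) * k ≈ (a * a) * (cc * k) + (b * b) * (d * k)
  solution-odd-expand = solve 5 (λ cc d a b k → (cc :* (a :* a) :+ d :* (b :* b)) :* k := (a :* a) :* (cc :* k) :+ (b :* b) :* (d :* k)) refl
  solution-odd : ∀ y s a b → (a * a) * (y - s * b) + (b * b) * (s * a - y) ≈ (y * (a + b) - s * (a * b)) * (a - b)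
  solution-odd = solve 4 (λ y s a b → (a :* a) :* (y :- s :* b) :+ (b :* b) :* (s :* a :- y) := (y :* (a :+ b) :- s :* (a :* b)) :* (a :- b)) refl

  add-sub : ∀ t y → t ≈ (t + y) - y
  add-sub = solve 2 (λ t y → t := (t :+ y) :- y) refl
  by-t-expand : ∀ y a b s → (y * (a + b) - s * (a * b)) * s ≈ y * (a * s + b * s) - (a * s) * (b * s)
  by-t-expand = solve 4 (λ y a b s → (y :* (a :+ b) :- s :* (a :* b)) :* s := y :* (a :* s :+ b :* s) :- (a :* s) :* (b :* s)) refl
  by-t-shifted : ∀ y t u → y * ((t + y) + (u + y)) - (t + y) * (u + y) ≈ y * y - u * t
  by-t-shifted = solve 3 (λ y t u → y :* ((t :+ y) :+ (u :+ y)) :- (t :+ y) :* (u :+ y) := y :* y :- u :* t) refl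
  by-t-discriminant : ∀ y s z → y * y - (y * y - s * z) ≈ z * s
  by-t-discriminant = solve 3 (λ y s z → y :* y :- (y :* y :- s :* z) := z :* s) refl
  *-neg-swap : ∀ y t → y * (- t) ≈ (- y) * t
  *-neg-swap = solve 2 (λ y t → y :* (:- t) := (:- y) :* t) refl

  sub-0* : ∀ y s → y - s * 0# ≈ y
  sub-0* = solve 2 (λ y s → y :- s :* :0 := y) refl
  add-diff : ∀ a w → a + (w - a) ≈ w
  add-diff = solve 2 (λ a w → a :+ (w :- a) := w) refl
  sub-0*w : ∀ y w → y - 0# * w ≈ y
  sub-0*w = solve 2 (λ y w → y :- :0 :* w := y) refl
  y0-combination : ∀ s w a b → 0# * (a + b) - s * w ≈ s * (- w)
  y0-combination = solve 4 (λ s w a b → :0 :* (a :+ b) :- s :* w := s :* (:- w)) refl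

  -- move-three: (-c)(Q(a) + Q(b)) part plus c Q(e)
  neg+self : ∀ c → - c + c ≈ 0#
  neg+self = solve 1 (λ c → :- c :+ c := :0) refl
  three-point-odd : ∀ c a b e → (- (c * e) * (a + b) - (- c) * (a * b)) + c * (e * e) ≈ c * ((a - e) * (b - e))
  three-point-odd = solve 4 (λ c a b e → (:- (c :* e) :* (a :+ b) :- (:- c) :* (a :* b)) :+ c :* (e :* e) := c :* ((a :- e) :* (b :- e))) refl

module Moves {c ℓ} (R : CommutativeRing c ℓ) (isF : IsField R)
         (_≟_ : (x y : CommutativeRing.Carrier R) → Dec (CommutativeRing._≈_ R x y))
         (q : ℕ) (LF : LargeField R q) where
  open FieldAlgebra R isF _≟_
  open Descriptors R isF _≟_
  open MoveIdentities R
  open LargeField LF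

  Move : ℕ → ℕ → F → F → F → Set (c ⊔ ℓ)
  Move r n s y z = Σ (List Item) λ m → (length m N.≤ n) × MoveSpec r m s y z

  Move≈ : ∀ {r n s y z s' y' z'} → s ≈ s' → y ≈ y' → z ≈ z' → Move r n s y z → Move r n s' y' z'
  Move≈ es ey ez (m , l , sp) = m , l , moveSpec-≈ es ey ez sp

  Move++ : ∀ {r n1 n2 s1 y1 z1 s2 y2 z2} → Move r n1 s1 y1 z1 → Move r n2 s2 y2 z2 →
           Move r (n1 N.+ n2) (s1 + s2) (y1 + y2) (z1 + z2)
  Move++ {r} {n1} {n2} {s1} {y1} {z1} {s2} {y2} {z2} (m1 , l1 , sp1) (m2 , l2 , sp2) =
    (m1 ++ m2) , P.subst (N._≤ n1 N.+ n2) (P.sym (length-++ m1)) (NP.+-mono-≤ l1 l2) ,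
    moveSpec-++ {r} {m1} {m2} {s1} {y1} {z1} {s2} {y2} {z2} sp1 sp2

  move-none : ∀ r → Move r 0 0# 0# 0#
  move-none r = [] , NP.≤-refl , moveSpec-[] r

  move-E : ∀ r y → Move r 1 0# y 0#
  move-E r y = ((y , E (suc r)) ∷ []) , NP.≤-refl , moveSpec-E r y

  move-one : ∀ r y z → ¬ (y ≈ 0#) → ¬ (z ≈ 0#) → Move r 1 ((y * y) / z) y z
  move-one r y z y0 z0 = ((σ , Q (suc r) (z / y)) ∷ []) , NP.≤-refl ,
      moveSpec-≈ {r} {_} {σ} {σ * (z / y)} {σ * ((z / y) * (z / y))} {σ} {y} {z} refl cy cz (moveSpec-Q r σ (z / y) (nz-/ z0 y0))
    where
    σ = (y * y) / z
    cy : ((y * y) / z) * (z / y) ≈ y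
    cy = begin
      ((y * y) * inv z) * (z * inv y) ≈⟨ one-point-even y z (inv y) (inv z) ⟩
      y * ((y * inv y) * (z * inv z)) ≈⟨ *-congˡ (*-cong (inv-r y0) (inv-r z0)) ⟩
      y * (1# * 1#) ≈⟨ *-1·1 y ⟩
      y ∎
    cz : ((y * y) / z) * ((z / y) * (z / y)) ≈ z
    cz = begin
      ((y * y) * inv z) * ((z * inv y) * (z * inv y))
        ≈⟨ one-point-odd y z (inv y) (inv z) ⟩
      z * ((y * inv y) * ((y * inv y) * (z * inv z))) ≈⟨ *-congˡ (*-cong (inv-r y0) (*-cong (inv-r y0) (inv-r z0))) ⟩
      z * (1# * (1# * 1#)) ≈⟨ *-1·1·1 z ⟩
      z ∎

  two-point-solution : ∀ s y a b → ¬ (a ≈ b) → Σ F λ cc → Σ F λ d →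
         (cc + d ≈ s) × (cc * a + d * b ≈ y) × (cc * (a * a) + d * (b * b) ≈ y * (a + b) - s * (a * b))
  two-point-solution s y a b ab = cc , d , p1 , p2 , p3
    where
    k = a - b
    kz : ¬ (k ≈ 0#)
    kz e = ab (diff0 e)
    cc = (y - s * b) / k
    d = (s * a - y) / k
    ck : cc * k ≈ y - s * b
    ck = div-mul _ kz
    dk : d * k ≈ s * a - y
    dk = div-mul _ kz
    p1 : cc + d ≈ s
    p1 = cancelʳ kz (begin
      (cc + d) * k ≈⟨ distribʳ k cc d ⟩
      cc * k + d * k ≈⟨ +-cong ck dk ⟩
      (y - s * b) + (s * a - y) ≈⟨ solution-sum y s a b ⟩
      s * k ∎)
    p2 : cc * a + d * b ≈ y
    p2 = cancelʳ kz (begin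
      (cc * a + d * b) * k ≈⟨ solution-even-expand cc d a b k ⟩
      a * (cc * k) + b * (d * k) ≈⟨ +-cong (*-congˡ ck) (*-congˡ dk) ⟩
      a * (y - s * b) + b * (s * a - y) ≈⟨ solution-even y s a b ⟩
      y * k ∎)
    p3 : cc * (a * a) + d * (b * b) ≈ y * (a + b) - s * (a * b)
    p3 = cancelʳ kz (begin
      (cc * (a * a) + d * (b * b)) * k
        ≈⟨ solution-odd-expand cc d a b k ⟩
      (a * a) * (cc * k) + (b * b) * (d * k) ≈⟨ +-cong (*-congˡ ck) (*-congˡ dk) ⟩
      (a * a) * (y - s * b) + (b * b) * (s * a - y)
        ≈⟨ solution-odd y s a b ⟩
      (y * (a + b) - s * (a * b)) * k ∎)

  move-two : ∀ r s y z a b → ¬ (a ≈ 0#) → ¬ (b ≈ 0#) → ¬ (a ≈ b) → y * (a + b) - s * (a * b) ≈ z → Move r 2 s y z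
  move-two r s y z a b a0 b0 ab eq = ((cc , Q (suc r) a) ∷ (d , Q (suc r) b) ∷ []) , NP.≤-refl ,
      moveSpec-≈ {r} {_} {cc + d} {cc * a + d * b} {cc * (a * a) + d * (b * b)} {s} {y} {z} p1 p2 (trans p3 eq)
        (moveSpec-++ {r} {(cc , Q (suc r) a) ∷ []} {(d , Q (suc r) b) ∷ []} {cc} {cc * a} {cc * (a * a)} {d} {d * b} {d * (b * b)}
          (moveSpec-Q r cc a a0) (moveSpec-Q r d b b0))
    where
    solution = two-point-solution s y a b ab
    cc = proj₁ solution
    d = proj₁ (proj₂ solution)
    p1 : cc + d ≈ s
    p1 = proj₁ (proj₂ (proj₂ solution))
    p2 : cc * a + d * b ≈ y
    p2 = proj₁ (proj₂ (proj₂ (proj₂ solution)))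
    p3 : cc * (a * a) + d * (b * b) ≈ y * (a + b) - s * (a * b)
    p3 = proj₂ (proj₂ (proj₂ (proj₂ solution)))

  avoid3 : ∀ x y z → Σ F λ a → ¬ (a ≈ x) × ¬ (a ≈ y) × ¬ (a ≈ z)
  avoid3 x y z with avoid (x ∷ y ∷ z ∷ []) 4≤q
  ... | a , (p ∷ p' ∷ p'' ∷ []) = a , p , p' , p''

  avoid2 : ∀ x y → Σ F λ a → ¬ (a ≈ x) × ¬ (a ≈ y)
  avoid2 x y with avoid3 x y y
  ... | a , p , p' , _ = a , p , p'

  -- Parametrising the two-point move by t = a s - y: with Δ = y² - s z and
  -- u = Δ / t, the choice a = (t + y)/s, b = (u + y)/s works provided these are
  -- nonzero and distinct.
  move-two-by-t : ∀ r s y z t → ¬ (s ≈ 0#) → ¬ (t ≈ 0#) → ¬ (t ≈ - y) →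
         ¬ (((y * y - s * z) / t) ≈ - y) → ¬ (t * t ≈ y * y - s * z) → Move r 2 s y z
  move-two-by-t r s y z t s0 t0 ty uy t²≉Δ = move-two r s y z a b a0 b0 ab eq
    where
    Δ u a b : F
    Δ = y * y - s * z
    u = Δ / t
    a = (t + y) / s
    b = (u + y) / s
    as : a * s ≈ t + y
    as = div-mul (t + y) s0
    bs : b * s ≈ u + y
    bs = div-mul (u + y) s0
    ut : u * t ≈ Δ
    ut = div-mul Δ t0
    a0 : ¬ (a ≈ 0#)
    a0 e = ty (sum0⇒neg (trans (sym as) (trans (*-congʳ e) (zeroˡ s))))
    b0 : ¬ (b ≈ 0#)
    b0 e = uy (sum0⇒neg (trans (sym bs) (trans (*-congʳ e) (zeroˡ s))))
    t≈u : a ≈ b → t ≈ u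
    t≈u e = begin
        t ≈⟨ add-sub t y ⟩
        (t + y) - y ≈⟨ +-congʳ (trans (sym as) (trans (*-congʳ e) bs)) ⟩
        (u + y) - y ≈⟨ sym (add-sub u y) ⟩
        u ∎
    ab : ¬ (a ≈ b)
    ab e = t²≉Δ (trans (*-congʳ (t≈u e)) ut)
    eq : y * (a + b) - s * (a * b) ≈ z
    eq = cancelʳ s0 (begin
      (y * (a + b) - s * (a * b)) * s
        ≈⟨ by-t-expand y a b s ⟩
      y * (a * s + b * s) - (a * s) * (b * s) ≈⟨ +-cong (*-congˡ (+-cong as bs)) (-‿cong (*-cong as bs)) ⟩
      y * ((t + y) + (u + y)) - (t + y) * (u + y)
        ≈⟨ by-t-shifted y t u ⟩
      y * y - u * t ≈⟨ +-congˡ (-‿cong ut) ⟩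
      y * y - (y * y - s * z) ≈⟨ by-t-discriminant y s z ⟩
      z * s ∎)

  quotient≈-y : ∀ Δ y t → ¬ (y ≈ 0#) → ¬ (t ≈ 0#) → (Δ / t) ≈ - y → t ≈ - (Δ / y)
  quotient≈-y Δ y t y0 t0 e = begin
    t ≈⟨ neg-involutive t ⟩
    - (- t) ≈⟨ -‿cong (cancelˡ y0 (begin
        y * (- t) ≈⟨ *-neg-swap y t ⟩
        (- y) * t ≈⟨ *-congʳ (sym e) ⟩
        (Δ / t) * t ≈⟨ div-mul Δ t0 ⟩
        Δ ≈⟨ sym (mul-div Δ y0) ⟩
        y * (Δ / y) ∎)) ⟩
    - (Δ / y) ∎

  move-z0 : ∀ r s y → ¬ (s ≈ 0#) → ¬ (y ≈ 0#) → Move r 2 s y 0#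
  move-z0 r s y s0 y0 with avoid3 0# (- y) y
  ... | t , t0 , t≉-y , t≉y = move-two-by-t r s y 0# t s0 t0 t≉-y uy t²≉Δ
    where
    Δ≈y² : y * y - s * 0# ≈ y * y
    Δ≈y² = sub-0* (y * y) s
    uy : ¬ (((y * y - s * 0#) / t) ≈ - y)
    uy e = t≉-y (trans (quotient≈-y (y * y - s * 0#) y t y0 t0 e)
                      (-‿cong (trans (*-congʳ Δ≈y²) (mul-div-cancel y y0))))
    t²≉Δ : ¬ (t * t ≈ y * y - s * 0#)
    t²≉Δ e = [ t≉y , t≉-y ]′ (sq-eq (trans e Δ≈y²))

  move-s0 : ∀ r y z → ¬ (y ≈ 0#) → ¬ (z ≈ 0#) → Move r 2 0# y z
  move-s0 r y z y0 z0 = go choose-a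
    where
    w = z / y
    w0 : ¬ (w ≈ 0#)
    w0 = nz-/ z0 y0
    choose-a : Σ F λ a → ¬ (a ≈ 0#) × ¬ (a ≈ w) × ¬ (a + a ≈ w)
    choose-a with (1# + 1#) ≟ 0#
    ... | yes 2≈0 with avoid2 0# w
    ...   | a , a0 , aw = a , a0 , aw , λ e → w0 (trans (sym e) (trans (two*a a) (trans (*-congʳ 2≈0) (zeroˡ a))))
    choose-a | no 2≉0 with avoid3 0# w (w / (1# + 1#))
    ...   | a , a0 , aw , ah = a , a0 , aw , λ e → ah (cancelˡ 2≉0 (trans (sym (two*a a)) (trans e (sym (mul-div w 2≉0)))))
    go : (Σ F λ a → ¬ (a ≈ 0#) × ¬ (a ≈ w) × ¬ (a + a ≈ w)) → Move r 2 0# y z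
    go (a , a0 , aw , aa) = move-two r 0# y z a b a0 b0 ab eq
      where
      b = w - a
      a+b≈w : a + b ≈ w
      a+b≈w = add-diff a w
      b0 : ¬ (b ≈ 0#)
      b0 e = aw (sym (diff0 e))
      ab : ¬ (a ≈ b)
      ab e = aa (trans (+-congˡ e) a+b≈w)
      eq : y * (a + b) - 0# * (a * b) ≈ z
      eq = begin
        y * (a + b) - 0# * (a * b) ≈⟨ +-congʳ (*-congˡ a+b≈w) ⟩
        y * w - 0# * (a * b) ≈⟨ sub-0*w (y * w) (a * b) ⟩
        y * w ≈⟨ mul-div z y0 ⟩
        z ∎

  move-y0 : ∀ r s z → ¬ (s ≈ 0#) → ¬ (z ≈ 0#) → Move r 2 s 0# z
  move-y0 r s z s0 z0 = go choose-a
    where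
    w = - (z / s)
    w0 : ¬ (w ≈ 0#)
    w0 = nz-neg (nz-/ z0 s0)
    choose-a : Σ F λ a → ¬ (a ≈ 0#) × ¬ (a * a ≈ w)
    choose-a with square? w
    ... | yes (δ , δδ) with avoid3 0# δ (- δ)
    ...   | a , a0 , ad , and = a , a0 , λ e → [ ad , and ]′ (sq-eq (trans e (sym δδ)))
    choose-a | no nr with avoid2 0# 0#
    ...   | a , a0 , _ = a , a0 , λ e → nr (a , e)
    go : (Σ F λ a → ¬ (a ≈ 0#) × ¬ (a * a ≈ w)) → Move r 2 s 0# z
    go (a , a0 , aa) = move-two r s 0# z a b a0 b0 ab eq
      where
      b = w / a
      b0 : ¬ (b ≈ 0#)
      b0 = nz-/ w0 a0
      ab : ¬ (a ≈ b)
      ab e = aa (trans (*-congˡ e) (mul-div w a0))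
      eq : 0# * (a + b) - s * (a * b) ≈ z
      eq = begin
        0# * (a + b) - s * (a * b) ≈⟨ +-congˡ (-‿cong (*-congˡ (mul-div w a0))) ⟩
        0# * (a + b) - s * w ≈⟨ y0-combination s w a b ⟩
        s * (- w) ≈⟨ *-congˡ (sym (neg-involutive (z / s))) ⟩
        s * (z / s) ≈⟨ mul-div z s0 ⟩
        z ∎

  move-general-7≤q : ∀ r s y z → ¬ (s ≈ 0#) → ¬ (y ≈ 0#) → 7 N.≤ q → Move r 2 s y z
  move-general-7≤q r s y z s0 y0 7≤q = go choose-t
    where
    Δ = y * y - s * z
    choose-t : Σ F λ t → ¬ (t ≈ 0#) × ¬ (t ≈ - y) × ¬ (t ≈ - (Δ / y)) × ¬ (t * t ≈ Δ)
    choose-t with square? Δ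
    ... | yes (δ , δδ) with avoid (0# ∷ - y ∷ - (Δ / y) ∷ δ ∷ - δ ∷ []) (NP.<-≤-trans (s≤s (s≤s (s≤s (s≤s (s≤s (s≤s z≤n)))))) 7≤q)
    ...   | t , (p0 ∷ p1 ∷ p2 ∷ p3 ∷ p4 ∷ []) = t , p0 , p1 , p2 , λ e → [ p3 , p4 ]′ (sq-eq (trans e (sym δδ)))
    choose-t | no nd with avoid3 0# (- y) (- (Δ / y))
    ...   | t , p0 , p1 , p2 = t , p0 , p1 , p2 , λ e → nd (t , e)
    go : (Σ F λ t → ¬ (t ≈ 0#) × ¬ (t ≈ - y) × ¬ (t ≈ - (Δ / y)) × ¬ (t * t ≈ Δ)) → Move r 2 s y z
    go (t , t0 , ty , tΔ , t²≉Δ) = move-two-by-t r s y z t s0 t0 ty (λ e → tΔ (quotient≈-y Δ y t y0 t0 e)) t²≉Δ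

  -- general (y, z) with s, y, z ≠ 0 and y² ≠ s z: if z/s = a² use s Q(a) and
  -- (y - s a) e_{2r+2}; otherwise q ≥ 7 and the two-point move applies
  move-general : ∀ r s y z → ¬ (s ≈ 0#) → ¬ (y ≈ 0#) → ¬ (z ≈ 0#) → Move r 2 s y z
  move-general r s y z s0 y0 z0 with square? (z / s)
  ... | yes (a , aa) = ((s , Q (suc r) a) ∷ (y - s * a , E (suc r)) ∷ []) , NP.≤-refl ,
        moveSpec-≈ (+-identityʳ s) (add-diff (s * a) y) s·a²≈z
          (moveSpec-++ {r} {(s , Q (suc r) a) ∷ []} {(y - s * a , E (suc r)) ∷ []} (moveSpec-Q r s a a0) (moveSpec-E r (y - s * a)))
    where
    a0 : ¬ (a ≈ 0#)
    a0 e = nz-/ z0 s0 (trans (sym aa) (trans (*-congʳ e) (zeroˡ a)))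
    s·a²≈z : s * (a * a) + 0# ≈ z
    s·a²≈z = trans (+-identityʳ _) (trans (*-congˡ aa) (mul-div z s0))
  ... | no nr = [ (λ all-sq → ⊥-elim (nr (all-sq (z / s)))) , move-general-7≤q r s y z s0 y0 ]′ all-squares-or-7≤q

  -- (0, z) with no side effect: the two-point move for (-c, -c e) plus c Q(e)
  move-three : ∀ r z → ¬ (z ≈ 0#) → Move r 3 0# 0# z
  move-three r z z0 with avoid2 0# 0#
  ... | a , a0 , _ with avoid2 0# a
  ... | b , b0 , ba with avoid3 0# a b
  ... | e , e0 , ea , eb = Move≈ (neg+self c3) (neg+self (c3 * e)) sum≈z
                            (Move++ two-points (((c3 , Q (suc r) e) ∷ []) , NP.≤-refl , moveSpec-Q r c3 e e0))
    where
    K = (a - e) * (b - e)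
    K0 : ¬ (K ≈ 0#)
    K0 = nz-* (λ x → ea (sym (diff0 x))) (λ x → eb (sym (diff0 x)))
    c3 = z / K
    z' = - (c3 * e) * (a + b) - (- c3) * (a * b)
    two-points : Move r 2 (- c3) (- (c3 * e)) z'
    two-points = move-two r (- c3) (- (c3 * e)) z' a b a0 b0 (λ x → ba (sym x)) refl
    sum≈z : z' + c3 * (e * e) ≈ z
    sum≈z = trans (three-point-odd c3 a b e)
                  (div-mul z K0)

module MembershipM {c ℓ} (R : CommutativeRing c ℓ)
         (_≟_ : (x y : CommutativeRing.Carrier R) → Dec (CommutativeRing._≈_ R x y)) where
  open CommutativeRing R renaming (Carrier to F)
  open Geometry R using (Mseq)
  open Parity

  NotMBelow : ℕ → (ℕ → F) → Set ℓ
  NotMBelow zero x = Lift ℓ ⊤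
  NotMBelow (suc r) x = ¬ Mseq r x

  M-elim : ∀ r x → Mseq r x → (x (2 N.* r) ≈ 0#) × ¬ (x (suc (2 N.* r)) ≈ 0#) × NotMBelow r x
  M-elim zero x (a , b) = a , b , lift tt
  M-elim (suc r) x (nm , a , b) = P.subst (λ i → x i ≈ 0#) (dim-eq r) a , P.subst (λ i → ¬ (x i ≈ 0#)) (odd-top-eq r) b , nm

  M-intro : ∀ r x → x (2 N.* r) ≈ 0# → ¬ (x (suc (2 N.* r)) ≈ 0#) → NotMBelow r x → Mseq r x
  M-intro zero x a b _ = a , b
  M-intro (suc r) x a b nm = nm , P.subst (λ i → x i ≈ 0#) (P.sym (dim-eq r)) a , P.subst (λ i → ¬ (x i ≈ 0#)) (P.sym (odd-top-eq r)) b

  M? : ∀ r x → Dec (Mseq r x)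
  M? zero x with x 0 ≟ 0# | x 1 ≟ 0#
  ... | yes a | yes b = no λ { (_ , nb) → nb b }
  ... | yes a | no b = yes (a , b)
  ... | no a | _ = no λ { (a' , _) → a a' }
  M? (suc r) x with M? r x | x (2 N.* r N.+ 2) ≟ 0# | x (2 N.* r N.+ 3) ≟ 0#
  ... | yes m | _ | _ = no λ { (nm , _) → nm m }
  ... | no nm | yes a | no b = yes (nm , a , b)
  ... | no nm | no a | _ = no λ { (_ , a' , _) → a a' }
  ... | no nm | yes a | yes b = no λ { (_ , _ , nb) → nb b }

  M-cong : ∀ r x w → (∀ j → j N.< 2 N.* suc r → x j ≈ w j) → Mseq r x → Mseq r w
  M-cong zero x w ag (a , b) = trans (sym (ag 0 (s≤s z≤n))) a , λ e → b (trans (ag 1 (s≤s (s≤s z≤n))) e)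
  M-cong (suc r) x w ag (nm , a , b) =
    (λ m → nm (M-cong r w x (λ j jl → sym (ag j (lift< jl))) m)) ,
    trans (sym (ag _ l2)) a , λ e → b (trans (ag _ l3) e)
    where
    lift< : ∀ {j} → j N.< 2 N.* suc r → j N.< 2 N.* suc (suc r)
    lift< jl = NP.<-≤-trans jl (NP.*-monoʳ-≤ 2 (NP.n≤1+n (suc r)))
    l3 : 2 N.* r N.+ 3 N.< 2 N.* suc (suc r)
    l3 = P.subst (N._< 2 N.* suc (suc r)) (P.sym (odd-top-eq r)) (P.subst (suc (2 N.* suc r) N.<_) (P.sym (dbl-suc (suc r))) (NP.n<1+n _))
    l2 : 2 N.* r N.+ 2 N.< 2 N.* suc (suc r)
    l2 = P.subst (N._< 2 N.* suc (suc r)) (P.sym (dim-eq r)) (P.subst (2 N.* suc r N.<_) (P.sym (dbl-suc (suc r))) (NP.<-trans (NP.n<1+n _) (NP.n<1+n _)))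

  NotMBelow-cong : ∀ r x w → (∀ j → j N.< 2 N.* r → x j ≈ w j) → NotMBelow r x → NotMBelow r w
  NotMBelow-cong zero x w ag l = l
  NotMBelow-cong (suc r) x w ag nm m = nm (M-cong r w x (λ j jl → sym (ag j jl)) m)

-- The covering theorem: by simultaneous induction on r,
--   (outside M) x ∉ M_r  ⇒  the first r+1 blocks of x are covered by r+1 points,
--   (any)       every x has its first r+1 blocks covered by r+2 points,
--   (zero top)  x_{2r} = x_{2r+1} = 0 and x ∉ M_{r-1}  ⇒  r points suffice.
module Covering {c ℓ} (R : CommutativeRing c ℓ) (isF : IsField R)
         (_≟_ : (x y : CommutativeRing.Carrier R) → Dec (CommutativeRing._≈_ R x y))
         (q : ℕ) (LF : LargeField R q) where
  open FieldAlgebra R isF _≟_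
  open Descriptors R isF _≟_
  open MembershipM R _≟_
  open Moves R isF _≟_ q LF
  open Geometry R using (Mseq)

  shift-low : ∀ x r s j → j N.< 2 N.* r → shift x r s j ≈ x j
  shift-low x r s j jl = trans (+-congˡ (-‿cong (*-congˡ (ev0< (NP.<-trans jl (NP.n<1+n _))))))
                               (solve 2 (λ x s → x :- s :* :0 := x) refl (x j) s)

  shift-low-agree : ∀ x r s s' j → j N.< 2 N.* r → shift x r s j ≈ shift x r s' j
  shift-low-agree x r s s' j jl = trans (shift-low x r s j jl) (sym (shift-low x r s' j jl))

  shift-even : ∀ x r s → shift x r s (2 N.* r) ≈ x (2 N.* r)
  shift-even x r s = trans (+-congˡ (-‿cong (*-congˡ (ev-oe r r)))) (solve 2 (λ x s → x :- s :* :0 := x) refl _ s)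

  shift-odd : ∀ x r s → shift x r s (suc (2 N.* r)) ≈ x (suc (2 N.* r)) - s
  shift-odd x r s = trans (+-congˡ (-‿cong (*-congˡ (ev1 (suc (2 N.* r)))))) (solve 2 (λ x s → x :- s :* :1 := x :- s) refl _ s)

  shift-odd-0 : ∀ x r → shift x r 0# (suc (2 N.* r)) ≈ x (suc (2 N.* r))
  shift-odd-0 x r = trans (shift-odd x r 0#) (trans (+-congˡ -0#≈0#) (+-identityʳ _))

  shift-clears : ∀ x r → shift x r (x (suc (2 N.* r))) (suc (2 N.* r)) ≈ 0#
  shift-clears x r = trans (shift-odd x r _) (-‿inverseʳ _)

  M-shift-zeroTop : ∀ x r s → Mseq r (shift x r s) →
    (shift x r (x (suc (2 N.* r))) (2 N.* r) ≈ 0#) × (shift x r (x (suc (2 N.* r))) (suc (2 N.* r)) ≈ 0#)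
    × NotMBelow r (shift x r (x (suc (2 N.* r))))
  M-shift-zeroTop x r s m with M-elim r (shift x r s) m
  ... | y0 , _ , low = trans (shift-even x r _) (trans (sym (shift-even x r s)) y0) , shift-clears x r ,
                       NotMBelow-cong r (shift x r s) _ (shift-low-agree x r s _) low

  extend-by-move : ∀ r {k n} x s → Cover r k (shift x r s) → Move r n s (x (2 N.* suc r)) (x (suc (2 N.* suc r))) → Cover (suc r) (k N.+ n) x
  extend-by-move r {k} x s cv (m , len , sp) = Cover-mono (NP.+-monoʳ-≤ k len) (extend-cover r x s m cv sp)

  CoverZeroTop CoverOutsideM CoverAny : ℕ → Set (c ⊔ ℓ)
  CoverZeroTop r = ∀ w → w (2 N.* r) ≈ 0# → w (suc (2 N.* r)) ≈ 0# → NotMBelow r w → Cover r r w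
  CoverOutsideM r = ∀ x → ¬ Mseq r x → Cover r (suc r) x
  CoverAny r = ∀ x → Cover r (suc (suc r)) x

  r+0 : ∀ r → r N.+ 0 N.≤ suc r
  r+0 r = NP.≤-trans (NP.≤-reflexive (NP.+-identityʳ r)) (NP.n≤1+n r)
  r+1 : ∀ r → suc r N.+ 1 N.≤ suc (suc r)
  r+1 r = NP.≤-reflexive (P.cong suc (NP.+-comm r 1))
  r+2 : ∀ r → r N.+ 2 N.≤ suc (suc r)
  r+2 r = NP.≤-reflexive (NP.+-comm r 2)

  -- Block r+1 of x is (y,z); x ∉ M_{r+1}.  Case on whether y, z vanish: move-one
  -- if x shifted by y²/z avoids M_r, otherwise a two-point move with side effect
  -- x_{2r+1} after which the lower blocks have zero top.
  outsideM-step : ∀ r → CoverOutsideM r → CoverAny r → CoverZeroTop r → CoverOutsideM (suc r)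
  outsideM-step r outM any zeroTop x nM with x (2 N.* suc r) ≟ 0# | x (suc (2 N.* suc r)) ≟ 0#
  ... | yes y0 | yes z0 with M? r (shift x r 0#)
  ...   | no nm = Cover-mono (r+0 (suc r)) (extend-by-move r x 0# (outM (shift x r 0#) nm) (Move≈ refl (sym y0) (sym z0) (move-none r)))
  ...   | yes _ = Cover-mono (NP.≤-reflexive (NP.+-identityʳ _)) (extend-by-move r x 0# (any (shift x r 0#)) (Move≈ refl (sym y0) (sym z0) (move-none r)))
  outsideM-step r outM any zeroTop x nM | no y0 | yes z0 with M? r (shift x r 0#)
  ...   | no nm = Cover-mono (r+1 r) (extend-by-move r x 0# (outM (shift x r 0#) nm) (Move≈ refl refl (sym z0) (move-E r _)))
  ...   | yes mw with M-shift-zeroTop x r 0# mw | M-elim r (shift x r 0#) mw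
  ...     | a , b , low | _ , z'≠0 , _ = Cover-mono (r+2 r) (extend-by-move r x z' (zeroTop _ a b low)
                                            (Move≈ refl refl (sym z0) (move-z0 r z' _ (λ e → z'≠0 (trans (shift-odd-0 x r) e)) y0)))
    where z' = x (suc (2 N.* r))
  outsideM-step r outM any zeroTop x nM | no y0 | no z0 with M? r (shift x r ((x (2 N.* suc r) * x (2 N.* suc r)) / x (suc (2 N.* suc r))))
  ...   | no nm = Cover-mono (r+1 r) (extend-by-move r x _ (outM _ nm) (move-one r _ _ y0 z0))
  ...   | yes mw with M-shift-zeroTop x r _ mw
  ...     | a , b , low = Cover-mono (r+2 r) (extend-by-move r x z' (zeroTop _ a b low) mv)
    where
    z' = x (suc (2 N.* r))
    mv : Move r 2 z' (x (2 N.* suc r)) (x (suc (2 N.* suc r)))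
    mv with z' ≟ 0#
    ... | yes z'0 = Move≈ (sym z'0) refl refl (move-s0 r _ _ y0 z0)
    ... | no z'0 = move-general r z' _ _ z'0 y0 z0
  outsideM-step r outM any zeroTop x nM | yes y0 | no z0 with M? r x
  ...   | no nm = ⊥-elim (nM (M-intro (suc r) x y0 z0 nm))
  ...   | yes m with M-elim r x m
  ...     | y'0 , z'≠0 , low = Cover-mono (r+2 r) (extend-by-move r x z' (zeroTop (shift x r z')
                                 (trans (shift-even x r z') y'0) (shift-clears x r)
                                 (NotMBelow-cong r x (shift x r z') (λ j jl → sym (shift-low x r z' j jl)) low))
                               (Move≈ refl (sym y0) refl (move-y0 r z' _ z'≠0 z0)))
    where z' = x (suc (2 N.* r))

  -- x ∈ M_{r+1}, so its top block is (0, z) with z ≠ 0: combine a two-point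
  -- move (or the three-point move) with a cover of the lower blocks.
  any-step : ∀ r → CoverOutsideM (suc r) → CoverOutsideM r → CoverZeroTop r → CoverAny (suc r)
  any-step r outM' outM zeroTop x with M? (suc r) x
  ... | no nm = Cover-mono (NP.n≤1+n _) (outM' x nm)
  ... | yes m with M-elim (suc r) x m
  ...   | y0 , z≠0 , _ with x (suc (2 N.* r)) ≟ 0#
  ...     | no z'0 = Cover-mono (NP.≤-reflexive (P.cong suc (NP.+-comm r 2)))
                       (extend-by-move r x z' (outM (shift x r z') notM) (Move≈ refl (sym y0) refl (move-y0 r z' _ z'0 z≠0)))
    where
    z' = x (suc (2 N.* r))
    notM : ¬ Mseq r (shift x r z')
    notM mw = proj₁ (proj₂ (M-elim r (shift x r z') mw)) (shift-clears x r)
  ...     | yes z'0 with M? r (shift x r 1#)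
  ...       | no nm1 = Cover-mono (NP.≤-reflexive (P.cong suc (NP.+-comm r 2)))
                         (extend-by-move r x 1# (outM (shift x r 1#) nm1) (Move≈ refl (sym y0) refl (move-y0 r 1# _ 1≉0 z≠0)))
  ...       | yes m1 with M-elim r (shift x r 1#) m1
  ...         | y'0 , _ , low = Cover-mono (NP.≤-reflexive (NP.+-comm r 3))
                         (extend-by-move r x 0# (zeroTop (shift x r 0#) (trans (shift-even x r 0#) (trans (sym (shift-even x r 1#)) y'0))
                                                 (trans (shift-odd-0 x r) z'0)
                                                 (NotMBelow-cong r (shift x r 1#) (shift x r 0#) (shift-low-agree x r 1# 0#) low))
                           (Move≈ refl (sym y0) refl (move-three r _ z≠0)))

  zeroTop-step : ∀ r → CoverOutsideM r → CoverZeroTop (suc r)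
  zeroTop-step r outM w y0 z0 low = Cover-mono (NP.≤-reflexive (NP.+-identityʳ _))
    (extend-by-move r w 0# (outM (shift w r 0#) (λ m → low (M-cong r (shift w r 0#) w (λ j _ → shift0 j) m)))
      (Move≈ refl (sym y0) (sym z0) (move-none r)))
    where
    shift0 : ∀ j → shift w r 0# j ≈ w j
    shift0 j = solve 2 (λ x e → x :- :0 :* e := x) refl (w j) _

  zeroTop-base : CoverZeroTop 0
  zeroTop-base w p q _ = [] , z≤n , [] , cv
    where
    cv : ∀ j → j N.< 2 → w j ≈ comb [] j
    cv zero _ = p
    cv (suc zero) _ = q
    cv (suc (suc j)) (s≤s (s≤s ()))

  cover-x0≠0 : ∀ x → ¬ (x 0 ≈ 0#) → Cover 0 1 x
  cover-x0≠0 x x0 = ((x 0 , P0 (x 1 / x 0)) ∷ []) , s≤s z≤n , (vP0 _ ∷ []) , cv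
    where
    cv : ∀ j → j N.< 2 → x j ≈ comb ((x 0 , P0 (x 1 / x 0)) ∷ []) j
    cv zero _ = sym (solve 2 (λ x a → x :* (:1 :+ a :* :0) :+ :0 := x) refl (x 0) (x 1 / x 0))
    cv (suc zero) _ = sym (trans (solve 2 (λ x a → x :* (:0 :+ a :* :1) :+ :0 := x :* a) refl (x 0) (x 1 / x 0)) (mul-div (x 1) x0))
    cv (suc (suc j)) (s≤s (s≤s ()))

  outsideM-base : CoverOutsideM 0
  outsideM-base x nM with x 0 ≟ 0#
  ... | no x0 = cover-x0≠0 x x0
  ... | yes x0 with x 1 ≟ 0#
  ...   | no x1 = ⊥-elim (nM (x0 , x1))
  ...   | yes x1 = [] , z≤n , [] , cv
    where
    cv : ∀ j → j N.< 2 → x j ≈ comb [] j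
    cv zero _ = x0
    cv (suc zero) _ = x1
    cv (suc (suc j)) (s≤s (s≤s ()))

  any-base : CoverAny 0
  any-base x with x 0 ≟ 0#
  ... | no x0 = Cover-mono (s≤s z≤n) (cover-x0≠0 x x0)
  ... | yes x0 = L , s≤s (s≤s z≤n) , (vP0 _ ∷ vP0 _ ∷ []) , cv
    where
    L = (x 1 , P0 1#) ∷ (- x 1 , P0 0#) ∷ []
    cv : ∀ j → j N.< 2 → x j ≈ comb L j
    cv zero _ = trans x0 (sym (solve 1 (λ x → x :* (:1 :+ :1 :* :0) :+ (:- x :* (:1 :+ :0 :* :0) :+ :0) := :0) refl (x 1)))
    cv (suc zero) _ = sym (solve 1 (λ x → x :* (:0 :+ :1 :* :1) :+ (:- x :* (:0 :+ :0 :* :1) :+ :0) := x) refl (x 1))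
    cv (suc (suc j)) (s≤s (s≤s ()))

  cover-outsideM : ∀ r → CoverOutsideM r
  cover-any : ∀ r → CoverAny r
  cover-zeroTop : ∀ r → CoverZeroTop r
  cover-outsideM zero = outsideM-base
  cover-outsideM (suc r) = outsideM-step r (cover-outsideM r) (cover-any r) (cover-zeroTop r)
  cover-any zero = any-base
  cover-any (suc r) = any-step r (cover-outsideM (suc r)) (cover-outsideM r) (cover-zeroTop r)
  cover-zeroTop zero = zeroTop-base
  cover-zeroTop (suc r) = zeroTop-step r (cover-outsideM r)

module PointsOfS {c ℓ} (R : CommutativeRing c ℓ) (isF : IsField R)
         (_≟_ : (x y : CommutativeRing.Carrier R) → Dec (CommutativeRing._≈_ R x y)) where
  open FieldAlgebra R isF _≟_
  open Descriptors R isF _≟_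
  open Parity
  open Geometry R
  open import Algebra.Properties.Monoid.Sum +-monoid using (sum; sum-cong-≋)

  NN : ℕ → ℕ
  NN ρ = 2 N.* ρ N.+ 2

  even<NN : ∀ ρ {b} → b N.≤ ρ → 2 N.* b N.< NN ρ
  even<NN ρ {b} p = P.subst (2 N.* b N.<_) (P.sym (dim-eq ρ))
    (NP.<-≤-trans (NP.n<1+n _) (NP.≤-trans (NP.n≤1+n _) (P.subst (N._≤ 2 N.* suc ρ) (dbl-suc b) (NP.*-monoʳ-≤ 2 (s≤s p)))))

  odd<NN : ∀ ρ {b} → b N.≤ ρ → suc (2 N.* b) N.< NN ρ
  odd<NN ρ {b} p = P.subst (suc (2 N.* b) N.<_) (P.sym (dim-eq ρ)) (P.subst (N._≤ 2 N.* suc ρ) (dbl-suc b) (NP.*-monoʳ-≤ 2 (s≤s p)))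

  coord-lookup : ∀ {n} (v : Vect n) (i : Fin n) → coord v (toℕ i) ≡ v i
  coord-lookup {suc n} v Fin.zero = P.refl
  coord-lookup {suc n} v (Fin.suc i) = coord-lookup {n} (λ j → v (Fin.suc j)) i

  coord-at : ∀ {n} (v : Vect n) m (p : m N.< n) → coord v m ≡ v (fromℕ< p)
  coord-at v m p = P.trans (P.cong (coord v) (P.sym (FP.toℕ-fromℕ< p))) (coord-lookup v (fromℕ< p))

  toVect : ∀ {n} → (ℕ → F) → Vect n
  toVect f j = f (toℕ j)

  coord-toVect : ∀ ρ (f : ℕ → F) n → n N.< NN ρ → coord {NN ρ} (toVect f) n ≡ f n
  coord-toVect ρ f n p = P.trans (coord-at (toVect f) n p) (P.cong f (FP.toℕ-fromℕ< p))

  vecV : ∀ {n} → D → Vect n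
  vecV d = toVect (vecD d)

  coeffsL : (l : List Item) → Fin (length l) → F
  coeffsL l i = proj₁ (lookup l i)
  pointsL : ∀ {n} (l : List Item) → Fin (length l) → Vect n
  pointsL l i = vecV (proj₂ (lookup l i))

  lincomb-comb : ∀ {n} (l : List Item) (j : Fin n) → lincomb (length l) (coeffsL l) (pointsL l) j ≈ comb l (toℕ j)
  lincomb-comb [] j = refl
  lincomb-comb ((a , d) ∷ l) j = +-congˡ (lincomb-comb l j)

  comb⇒lincomb : ∀ ρ (S : PointSet (NN ρ)) (A : Vect (NN ρ)) (l : List Item) →
           All (λ it → S (vecV (proj₂ it))) l →
           (∀ j → j N.< 2 N.* suc ρ → coord A j ≈ comb l j) → CombOfAtMost (length l) S A
  comb⇒lincomb ρ S A l mem cov = length l , NP.≤-refl , coeffsL l , pointsL l , (λ i → All.lookup mem (∈-lookup i)) , λ j → begin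
    A j ≈⟨ reflexive (P.sym (coord-lookup A j)) ⟩
    coord A (toℕ j) ≈⟨ cov (toℕ j) (P.subst (toℕ j N.<_) (dim-eq ρ) (FP.toℕ<n j)) ⟩
    comb l (toℕ j) ≈⟨ sym (lincomb-comb l j) ⟩
    lincomb (length l) (coeffsL l) (pointsL l) j ∎

  CombOfAtMost-mono : ∀ {n m m'} {S : PointSet n} {A} → m N.≤ m' → CombOfAtMost m S A → CombOfAtMost m' S A
  CombOfAtMost-mono le (k , kle , rest) = k , NP.≤-trans kle le , rest

  valid⇒S : ∀ {ρ d} → Valid ρ d → Sρ ρ (vecV d)
  valid⇒S {ρ} {P0 a} (vP0 .a) with a ≟ 0#
  ... | yes a0 = inj₁ λ j → trans (+-congˡ (trans (*-congʳ a0) (zeroˡ _))) (+-identityʳ _)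
  ... | no a0 = inj₂ (inj₁ (a , a0 , λ j → refl))
  valid⇒S {ρ} {Q (suc w) a} (vQ p a0) = inj₂ (inj₂ (inj₁ (suc w , s≤s z≤n , p , a , a0 , λ j → refl)))
  valid⇒S {ρ} {E (suc w)} (vE p) = inj₂ (inj₂ (inj₂ (inj₁ (suc w , s≤s z≤n , p , λ j → refl))))

  top⇒S : ∀ ρ → Sρ ρ (vecV (Top ρ))
  top⇒S ρ = inj₂ (inj₂ (inj₂ (inj₂ λ j → refl)))

  not-top-at : ∀ ρ d m (p : m N.< NN ρ) → vecD d m ≈ 1# → m ≢ suc (2 N.* ρ) → ¬ (vecV {NN ρ} d ≈ᵥ e (2 N.* ρ N.+ 1))
  not-top-at ρ d m p d1 ne H = 1≉0 (begin
      1# ≈⟨ sym d1 ⟩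
      vecD d m ≈⟨ reflexive (P.sym (P.cong (vecD d) (FP.toℕ-fromℕ< p))) ⟩
      vecV d (fromℕ< p) ≈⟨ H (fromℕ< p) ⟩
      e (2 N.* ρ N.+ 1) (fromℕ< p) ≈⟨ reflexive (P.cong (ev (2 N.* ρ N.+ 1)) (FP.toℕ-fromℕ< p)) ⟩
      ev (2 N.* ρ N.+ 1) m ≈⟨ ev0 (λ eq → ne (P.trans eq (odd-eq ρ))) ⟩
      0# ∎)

  valid-not-top : ∀ {ρ d} → Valid ρ d → ¬ (vecV {NN ρ} d ≈ᵥ e (2 N.* ρ N.+ 1))
  valid-not-top {ρ} (vP0 a) = not-top-at ρ (P0 a) 0 (even<NN ρ z≤n) (P0-first a) (λ ())
  valid-not-top {ρ} (vQ {w} {a} wl a0) = not-top-at ρ (Q (suc w) a) _ (odd<NN ρ (NP.<⇒≤ wl)) (Q-side w a)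
                                           (λ eq → NP.<⇒≢ wl (dbl-inj (NP.suc-injective eq)))
  valid-not-top {ρ} (vE {w} wl) = not-top-at ρ (E (suc w)) _ (even<NN ρ wl) (ev1 (2 N.* suc w)) (NP.even≢odd (suc w) ρ)

  valid⇒S⁻ : ∀ {ρ d} → Valid ρ d → Sρ⁻ ρ (vecV d)
  valid⇒S⁻ v = valid⇒S v , valid-not-top v

  cover⇒S⁻ : ∀ ρ {k} (A : Vect (NN ρ)) → Cover ρ k (coord A) → CombOfAtMost k (Sρ⁻ ρ) A
  cover⇒S⁻ ρ A (l , len , vl , cov) = CombOfAtMost-mono {S = Sρ⁻ ρ} {A = A} len (comb⇒lincomb ρ (Sρ⁻ ρ) A l (All.map valid⇒S⁻ vl) cov)

  cover⇒S : ∀ ρ {k} (A : Vect (NN ρ)) → Cover ρ k (coord A) → CombOfAtMost k (Sρ ρ) A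
  cover⇒S ρ A (l , len , vl , cov) = CombOfAtMost-mono {S = Sρ ρ} {A = A} len (comb⇒lincomb ρ (Sρ ρ) A l (All.map valid⇒S vl) cov)

  ValidOrTop : ℕ → D → Set (c ⊔ ℓ)
  ValidOrTop ρ d = Valid ρ d ⊎ Lift ℓ (d ≡ Top ρ)

  describe : ∀ {ρ} {v : Vect (NN ρ)} → Sρ ρ v → Σ D λ d → ValidOrTop ρ d × (v ≈ᵥ vecV d)
  describe (inj₁ H) = P0 0# , inj₁ (vP0 0#) , λ j → trans (H j) (sym (trans (+-congˡ (zeroˡ _)) (+-identityʳ _)))
  describe (inj₂ (inj₁ (a , a0 , H))) = P0 a , inj₁ (vP0 a) , H
  describe (inj₂ (inj₂ (inj₁ (suc w , s≤s z≤n , ul , a , a0 , H)))) = Q (suc w) a , inj₁ (vQ ul a0) , H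
  describe (inj₂ (inj₂ (inj₂ (inj₁ (suc w , s≤s z≤n , ul , H))))) = E (suc w) , inj₁ (vE ul) , H
  describe {ρ} (inj₂ (inj₂ (inj₂ (inj₂ H)))) = Top ρ , inj₂ (lift P.refl) , H

  lincomb-sum : ∀ {n} k cs (ps : Fin k → Vect n) j → lincomb k cs ps j ≈ sum (λ i → cs i * ps i j)
  lincomb-sum zero cs ps j = refl
  lincomb-sum (suc k) cs ps j = +-congˡ (lincomb-sum k (λ i → cs (Fin.suc i)) (λ i → ps (Fin.suc i)) j)

  sum-0 : ∀ k {f : Fin k → F} → (∀ i → f i ≈ 0#) → sum f ≈ 0#
  sum-0 zero h = refl
  sum-0 (suc k) h = trans (+-cong (h Fin.zero) (sum-0 k (λ i → h (Fin.suc i)))) (+-identityʳ 0#)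

  sum-nz : ∀ k {f : Fin k → F} → ¬ (sum f ≈ 0#) → ∃ λ i → ¬ (f i ≈ 0#)
  sum-nz zero nz = ⊥-elim (nz refl)
  sum-nz (suc k) {f} nz with f Fin.zero ≟ 0#
  ... | no p = Fin.zero , p
  ... | yes p with sum-nz k {λ i → f (Fin.suc i)} (λ e → nz (trans (+-cong p e) (+-identityʳ 0#)))
  ...   | i , q' = Fin.suc i , q'

  sum-1 : ∀ k {f : Fin k → F} i0 → (∀ i → i ≢ i0 → f i ≈ 0#) → sum f ≈ f i0
  sum-1 (suc k) Fin.zero h = trans (+-congˡ (sum-0 k (λ i → h (Fin.suc i) (λ ())))) (+-identityʳ _)
  sum-1 (suc k) (Fin.suc i0) h =
    trans (+-cong (h Fin.zero (λ ())) (sum-1 k i0 (λ i ne → h (Fin.suc i) (λ e → ne (FP.suc-injective e))))) (+-identityˡ _)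

  sum-2 : ∀ k {f : Fin k → F} i0 i1 → i0 ≢ i1 → (∀ i → i ≢ i0 → i ≢ i1 → f i ≈ 0#) → sum f ≈ f i0 + f i1
  sum-2 (suc k) Fin.zero Fin.zero ne h = ⊥-elim (ne P.refl)
  sum-2 (suc k) Fin.zero (Fin.suc i1) ne h =
    +-congˡ (sum-1 k i1 (λ i ne' → h (Fin.suc i) (λ ()) (λ e → ne' (FP.suc-injective e))))
  sum-2 (suc k) (Fin.suc i0) Fin.zero ne h =
    trans (+-congˡ (sum-1 k i0 (λ i ne' → h (Fin.suc i) (λ e → ne' (FP.suc-injective e)) (λ ())))) (+-comm _ _)
  sum-2 (suc k) (Fin.suc i0) (Fin.suc i1) ne h =
    trans (+-cong (h Fin.zero (λ ()) (λ ())) (sum-2 k i0 i1 (λ e → ne (P.cong Fin.suc e))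
      (λ i n0 n1 → h (Fin.suc i) (λ e → n0 (FP.suc-injective e)) (λ e → n1 (FP.suc-injective e))))) (+-identityˡ _)

  record Decomp (ρ : ℕ) (m : ℕ) (A : Vect (NN ρ)) : Set (c ⊔ ℓ) where
    field
      k : ℕ
      k≤m : k N.≤ m
      cs : Fin k → F
      ds : Fin k → D
      valid : ∀ i → ValidOrTop ρ (ds i)
      points : Fin k → Vect (NN ρ)
      points≈ : ∀ i → points i ≈ᵥ vecV (ds i)
      coord-sum : ∀ n → n N.< NN ρ → coord A n ≈ sum (λ i → cs i * vecD (ds i) n)

  decompose : ∀ ρ m (S : PointSet (NN ρ)) (A : Vect (NN ρ)) → (∀ v → S v → Sρ ρ v) →
              CombOfAtMost m S A → Decomp ρ m A
  decompose ρ m S A sub (k , k≤m , cs , ps , mem , eq) = record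
    { k = k ; k≤m = k≤m ; cs = cs ; ds = λ i → proj₁ (X i) ; valid = λ i → proj₁ (proj₂ (X i))
    ; points = ps ; points≈ = λ i → proj₂ (proj₂ (X i)) ; coord-sum = coord-sum }
    where
    X : ∀ i → Σ D λ d → ValidOrTop ρ d × (ps i ≈ᵥ vecV d)
    X i = describe (sub _ (mem i))
    coord-sum : ∀ n → n N.< NN ρ → coord A n ≈ sum (λ i → cs i * vecD (proj₁ (X i)) n)
    coord-sum n p = begin
      coord A n ≈⟨ reflexive (coord-at A n p) ⟩
      A (fromℕ< p) ≈⟨ eq (fromℕ< p) ⟩
      lincomb k cs ps (fromℕ< p) ≈⟨ lincomb-sum k cs ps (fromℕ< p) ⟩
      sum (λ i → cs i * ps i (fromℕ< p))
        ≈⟨ sum-cong-≋ (λ i → *-congˡ (trans (proj₂ (proj₂ (X i)) (fromℕ< p)) (reflexive (P.cong (vecD (proj₁ (X i))) (FP.toℕ-fromℕ< p))))) ⟩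
      sum (λ i → cs i * vecD (proj₁ (X i)) n) ∎

  decompose-valid : ∀ ρ m (S : PointSet (NN ρ)) (A : Vect (NN ρ)) (sub : ∀ v → S v → Sρ ρ v) →
         (∀ w → S w → ¬ (w ≈ᵥ vecV (Top ρ))) → (C : CombOfAtMost m S A) →
         ∀ i → Valid ρ (Decomp.ds (decompose ρ m S A sub C) i)
  decompose-valid ρ m S A sub nt C@(k , k≤m , cs , ps , mem , eq) i =
    [ (λ v → v) , (λ { (lift e) → ⊥-elim (nt (ps i) (mem i) (λ j → trans (Decomp.points≈ Dc i j) (reflexive (P.cong (λ d → vecV d j) e)))) }) ]′ (Decomp.valid Dc i)
    where Dc = decompose ρ m S A sub C

-- In a decomposed combination, a nonzero
-- coordinate x_{2b} forces a point in block b, and x_{2ρ} = 0 with x_{2ρ+1} ≠ 0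
-- forces two points in block ρ (when e_{2ρ+1} is unavailable).  Hence
-- Σ_{u≤ρ} e_{2u} needs ρ+1 points and Σ_{u<ρ} e_{2u} + e_{2ρ+1} needs ρ+2.
module BlockCounting {c ℓ} (R : CommutativeRing c ℓ) (isF : IsField R)
         (_≟_ : (x y : CommutativeRing.Carrier R) → Dec (CommutativeRing._≈_ R x y)) where
  open FieldAlgebra R isF _≟_
  open Descriptors R isF _≟_
  open PointsOfS R isF _≟_
  open Parity
  open Geometry R

  even-coord-block : ∀ {ρ d} b → ValidOrTop ρ d → ¬ (vecD d (2 N.* b) ≈ 0#) → block d ≡ b
  even-coord-block {ρ} {P0 a} b v nz with b N.≟ 0
  ... | yes e = P.sym e
  ... | no ne = ⊥-elim (nz (begin
    ev 0 (2 N.* b) + a * ev 1 (2 N.* b) ≈⟨ +-cong (ev-ee 0 b (λ e → ne (P.sym e))) (*-congˡ (ev-oe 0 b)) ⟩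
    0# + a * 0# ≈⟨ solve 1 (λ a → :0 :+ a :* :0 := :0) refl a ⟩
    0# ∎))
  even-coord-block {ρ} {Q (suc w) a} b v nz with b N.≟ suc w
  ... | yes e = P.sym e
  ... | no ne = ⊥-elim (nz (begin
    vecD (Q (suc w) a) (2 N.* b) ≈⟨ reflexive (vecQ w a (2 N.* b)) ⟩
    (ev (suc (2 N.* w)) (2 N.* b) + a * ev (2 N.* suc w) (2 N.* b)) + (a * a) * ev (suc (2 N.* suc w)) (2 N.* b)
      ≈⟨ +-cong (+-cong (ev-oe w b) (*-congˡ (ev-ee (suc w) b (λ e → ne (P.sym e))))) (*-congˡ (ev-oe (suc w) b)) ⟩
    (0# + a * 0#) + (a * a) * 0# ≈⟨ solve 1 (λ a → (:0 :+ a :* :0) :+ (a :* a) :* :0 := :0) refl a ⟩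
    0# ∎))
  even-coord-block {ρ} {E (suc w)} b v nz with b N.≟ suc w
  ... | yes e = P.sym e
  ... | no ne = ⊥-elim (nz (ev-ee (suc w) b (λ e → ne (P.sym e))))
  even-coord-block {ρ} {Top r} b v nz = ⊥-elim (nz (trans (reflexive (vecTop r (2 N.* b))) (ev-oe r b)))
  even-coord-block {ρ} {Q zero a} b (inj₁ ()) nz
  even-coord-block {ρ} {Q zero a} b (inj₂ (lift ())) nz
  even-coord-block {ρ} {E zero} b (inj₁ ()) nz
  even-coord-block {ρ} {E zero} b (inj₂ (lift ())) nz

  even-coord-own : ∀ {ρ d} → Valid ρ d → ¬ (vecD d (2 N.* block d) ≈ 0#)
  even-coord-own (vP0 a) e = 1≉0 (trans (sym (P0-first a)) e)
  even-coord-own {ρ} {Q (suc w) a} (vQ p a0) e = a0 (trans (sym (Q-even w a)) e)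
  even-coord-own {ρ} {E (suc w)} (vE p) e = 1≉0 (trans (sym (ev1 (2 N.* suc w))) e)

  odd-coord-block : ∀ {ρ d} b → ValidOrTop ρ d → ¬ (vecD d (suc (2 N.* b)) ≈ 0#) → block d ≡ b ⊎ block d ≡ suc b
  odd-coord-block {ρ} {P0 a} b v nz with b N.≟ 0
  ... | yes e = inj₁ (P.sym e)
  ... | no ne = ⊥-elim (nz (begin
    ev 0 (suc (2 N.* b)) + a * ev 1 (suc (2 N.* b)) ≈⟨ +-cong (ev-eo 0 b) (*-congˡ (ev-oo 0 b (λ e → ne (P.sym e)))) ⟩
    0# + a * 0# ≈⟨ solve 1 (λ a → :0 :+ a :* :0 := :0) refl a ⟩
    0# ∎))
  odd-coord-block {ρ} {Q (suc w) a} b v nz with b N.≟ w | b N.≟ suc w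
  ... | yes e | _ = inj₂ (P.cong suc (P.sym e))
  ... | no _ | yes e = inj₁ (P.sym e)
  ... | no n1 | no n2 = ⊥-elim (nz (begin
    vecD (Q (suc w) a) (suc (2 N.* b)) ≈⟨ reflexive (vecQ w a (suc (2 N.* b))) ⟩
    (ev (suc (2 N.* w)) (suc (2 N.* b)) + a * ev (2 N.* suc w) (suc (2 N.* b))) + (a * a) * ev (suc (2 N.* suc w)) (suc (2 N.* b))
      ≈⟨ +-cong (+-cong (ev-oo w b (λ e → n1 (P.sym e))) (*-congˡ (ev-eo (suc w) b))) (*-congˡ (ev-oo (suc w) b (λ e → n2 (P.sym e)))) ⟩
    (0# + a * 0#) + (a * a) * 0# ≈⟨ solve 1 (λ a → (:0 :+ a :* :0) :+ (a :* a) :* :0 := :0) refl a ⟩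
    0# ∎))
  odd-coord-block {ρ} {E (suc w)} b v nz = ⊥-elim (nz (ev-eo (suc w) b))
  odd-coord-block {ρ} {Top r} b v nz with b N.≟ r
  ... | yes e = inj₂ (P.cong suc (P.sym e))
  ... | no ne = ⊥-elim (nz (trans (reflexive (vecTop r (suc (2 N.* b)))) (ev-oo r b (λ e → ne (P.sym e)))))
  odd-coord-block {ρ} {Q zero a} b (inj₁ ()) nz
  odd-coord-block {ρ} {Q zero a} b (inj₂ (lift ())) nz
  odd-coord-block {ρ} {E zero} b (inj₁ ()) nz
  odd-coord-block {ρ} {E zero} b (inj₂ (lift ())) nz

  even-coord-zero-or-block : ∀ {ρ d} b → ValidOrTop ρ d → vecD d (2 N.* b) ≈ 0# ⊎ block d ≡ b
  even-coord-zero-or-block {ρ} {d} b v with vecD d (2 N.* b) ≟ 0#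
  ... | yes z = inj₁ z
  ... | no nz = inj₂ (even-coord-block b v nz)

  odd-coord-zero-or-block : ∀ {ρ d} b → ValidOrTop ρ d → vecD d (suc (2 N.* b)) ≈ 0# ⊎ (block d ≡ b ⊎ block d ≡ suc b)
  odd-coord-zero-or-block {ρ} {d} b v with vecD d (suc (2 N.* b)) ≟ 0#
  ... | yes z = inj₁ z
  ... | no nz = inj₂ (odd-coord-block b v nz)

  above-top : ∀ {ρ d} → Valid ρ d → ¬ (block d ≡ suc ρ)
  above-top v e = NP.<-irrefl P.refl (P.subst (N._≤ _) e (block≤ v))

  labels-attained : ∀ {k} (label : Fin k → ℕ) m → (∀ t → t N.< m → ∃ λ i → label i ≡ t) → m N.≤ k
  labels-attained {k} label m h with m N.≤? k
  ... | yes p = p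
  ... | no np with FP.pigeonhole (NP.≰⇒> np) (λ t → proj₁ (h (toℕ t) (FP.toℕ<n t)))
  ...   | t , t' , t<t' , eq = ⊥-elim (FP.<⇒≢ t<t' (FP.toℕ-injective
            (P.trans (P.sym (proj₂ (h (toℕ t) (FP.toℕ<n t)))) (P.trans (P.cong label eq) (proj₂ (h (toℕ t') (FP.toℕ<n t')))))))

  relabel : ∀ {k} → Fin k → ℕ → (Fin k → ℕ) → Fin k → ℕ
  relabel i₀ v f i with i Fin.≟ i₀
  ... | yes _ = v
  ... | no _ = f i

  relabel-same : ∀ {k} (i₀ : Fin k) v f → relabel i₀ v f i₀ ≡ v
  relabel-same i₀ v f with i₀ Fin.≟ i₀
  ... | yes _ = P.refl
  ... | no ne = ⊥-elim (ne P.refl)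

  relabel-other : ∀ {k} (i₀ : Fin k) v f i → i ≢ i₀ → relabel i₀ v f i ≡ f i
  relabel-other i₀ v f i ne with i Fin.≟ i₀
  ... | yes e = ⊥-elim (ne e)
  ... | no _ = P.refl

  evens : ℕ → ℕ → F
  evens zero j = 0#
  evens (suc r) zero = 1#
  evens (suc r) (suc zero) = 0#
  evens (suc r) (suc (suc j)) = evens r j

  evens-< : ∀ r b → b N.< r → evens r (2 N.* b) ≡ 1#
  evens-< (suc r) zero _ = P.refl
  evens-< (suc r) (suc b) (s≤s p) = P.trans (P.cong (evens (suc r)) (dbl-suc b)) (evens-< r b p)

  evens-≥ : ∀ r b → r N.≤ b → evens r (2 N.* b) ≡ 0#
  evens-≥ zero b _ = P.refl
  evens-≥ (suc r) (suc b) (s≤s p) = P.trans (P.cong (evens (suc r)) (dbl-suc b)) (evens-≥ r b p)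

  evens-odd : ∀ r b → evens r (suc (2 N.* b)) ≡ 0#
  evens-odd zero b = P.refl
  evens-odd (suc r) zero = P.refl
  evens-odd (suc r) (suc b) = P.trans (P.cong (λ i → evens (suc r) (suc i)) (dbl-suc b)) (evens-odd r b)

  module _ {ρ m} {A : Vect (NN ρ)} (Dc : Decomp ρ m A) where
    open Decomp Dc

    nonzero-term : ∀ n → n N.< NN ρ → ¬ (coord A n ≈ 0#) → ∃ λ i → ¬ (cs i ≈ 0#) × ¬ (vecD (ds i) n ≈ 0#)
    nonzero-term n p nz with sum-nz k (λ e → nz (trans (coord-sum n p) e))
    ... | i , h = i , (λ e → h (trans (*-congʳ e) (zeroˡ _))) , (λ e → h (trans (*-congˡ e) (zeroʳ _)))

    point-in-block : ∀ b → b N.≤ ρ → ¬ (coord A (2 N.* b) ≈ 0#) → ∃ λ i → block (ds i) ≡ b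
    point-in-block b bl nz = i , even-coord-block b (valid i) (proj₂ (proj₂ X))
      where
      X = nonzero-term (2 N.* b) (even<NN ρ bl) nz
      i = proj₁ X

    -- x_{2ρ} = 0 and x_{2ρ+1} ≠ 0: the point producing x_{2ρ+1} is in block ρ,
    -- and if it were alone there its (nonzero) even coordinate would survive
    two-points-in-top-block : (∀ i → Valid ρ (ds i)) → coord A (2 N.* ρ) ≈ 0# → ¬ (coord A (suc (2 N.* ρ)) ≈ 0#) →
             Σ (Fin k) λ i1 → Σ (Fin k) λ i2 → i1 ≢ i2 × block (ds i1) ≡ ρ × block (ds i2) ≡ ρ
    two-points-in-top-block vl y0 z≠0 = go
      where
      X = nonzero-term (suc (2 N.* ρ)) (odd<NN ρ NP.≤-refl) z≠0
      i1 = proj₁ X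
      h1 = proj₂ (proj₂ X)
      bk1 : block (ds i1) ≡ ρ
      bk1 = [ (λ e → e) , (λ e → ⊥-elim (above-top (vl i1) e)) ]′ (odd-coord-block ρ (valid i1) h1)
      go : Σ (Fin k) λ i1 → Σ (Fin k) λ i2 → i1 ≢ i2 × block (ds i1) ≡ ρ × block (ds i2) ≡ ρ
      go with FP.any? (λ i → ¬? (i Fin.≟ i1) ×-dec (block (ds i) N.≟ ρ))
      ... | yes (i2 , ne , b2) = i1 , i2 , (λ e → ne (P.sym e)) , bk1 , b2
      ... | no alone = ⊥-elim (z≠0 (trans (coord-sum _ (odd<NN ρ NP.≤-refl)) (trans (sum-1 k i1 others-odd) (trans (*-congʳ c0) (zeroˡ _)))))
        where
        others-even : ∀ i → i ≢ i1 → vecD (ds i) (2 N.* ρ) ≈ 0#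
        others-even i ne = [ (λ z → z) , (λ e → ⊥-elim (alone (i , ne , e))) ]′ (even-coord-zero-or-block ρ (valid i))
        c0 : cs i1 ≈ 0#
        c0 = [ (λ e → e) , (λ e → ⊥-elim (even-coord-own (vl i1) (P.subst (λ b → vecD (ds i1) (2 N.* b) ≈ 0#) (P.sym bk1) e))) ]′
               (zero-prod (trans (sym (sum-1 k i1 (λ i ne → trans (*-congˡ (others-even i ne)) (zeroʳ _))))
                                 (trans (sym (coord-sum _ (even<NN ρ NP.≤-refl))) y0)))
        others-odd : ∀ i → i ≢ i1 → cs i * vecD (ds i) (suc (2 N.* ρ)) ≈ 0#
        others-odd i ne = [ (λ z → trans (*-congˡ z) (zeroʳ _)) ,
                            [ (λ e → ⊥-elim (alone (i , ne , e))) , (λ e → ⊥-elim (above-top (vl i) e)) ]′ ]′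
                          (odd-coord-zero-or-block ρ (valid i))

  sumEvens : ∀ ρ → Vect (NN ρ)
  sumEvens ρ = toVect (evens (suc ρ))

  sumEvens-needs : ∀ ρ {m} (Dc : Decomp ρ m (sumEvens ρ)) → suc ρ N.≤ Decomp.k Dc
  sumEvens-needs ρ Dc = labels-attained (λ i → block (Decomp.ds Dc i)) (suc ρ) hit
    where
    hit : ∀ t → t N.< suc ρ → ∃ λ i → block (Decomp.ds Dc i) ≡ t
    hit t (s≤s tl) = point-in-block Dc t tl (λ e → 1≉0 (trans (sym (reflexive
      (P.trans (coord-toVect ρ (evens (suc ρ)) (2 N.* t) (even<NN ρ tl)) (evens-< (suc ρ) t (s≤s tl))))) e))

  evensTop : ℕ → ℕ → F
  evensTop ρ n = evens ρ n + ev (suc (2 N.* ρ)) n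

  sumEvensTop : ∀ ρ → Vect (NN ρ)
  sumEvensTop ρ = toVect (evensTop ρ)

  -- Σ_{u<ρ} e_{2u} + e_{2ρ+1} needs ρ+2 valid points: one in each block u < ρ
  -- and two in block ρ; relabelling the second one by ρ+1 attains all labels ≤ ρ+1
  sumEvensTop-needs : ∀ ρ {m} (Dc : Decomp ρ m (sumEvensTop ρ)) → (∀ i → Valid ρ (Decomp.ds Dc i)) → suc (suc ρ) N.≤ Decomp.k Dc
  sumEvensTop-needs ρ Dc vl = labels-attained label (suc (suc ρ)) hit
    where
    open Decomp Dc
    cx : ∀ n → n N.< NN ρ → coord (sumEvensTop ρ) n ≈ evensTop ρ n
    cx n p = reflexive (coord-toVect ρ (evensTop ρ) n p)
    y0 : coord (sumEvensTop ρ) (2 N.* ρ) ≈ 0#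
    y0 = trans (cx _ (even<NN ρ NP.≤-refl)) (trans (+-cong (reflexive (evens-≥ ρ ρ NP.≤-refl)) (ev-oe ρ ρ)) (+-identityʳ 0#))
    z1 : ¬ (coord (sumEvensTop ρ) (suc (2 N.* ρ)) ≈ 0#)
    z1 e = 1≉0 (trans (sym (trans (+-cong (reflexive (evens-odd ρ ρ)) (ev1 (suc (2 N.* ρ)))) (+-identityˡ 1#)))
                      (trans (sym (cx _ (odd<NN ρ NP.≤-refl))) e))
    T = two-points-in-top-block Dc vl y0 z1
    i1 = proj₁ T
    i2 = proj₁ (proj₂ T)
    i1≢i2 : i1 ≢ i2
    i1≢i2 = proj₁ (proj₂ (proj₂ T))
    b1 : block (ds i1) ≡ ρ
    b1 = proj₁ (proj₂ (proj₂ (proj₂ T)))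
    b2 : block (ds i2) ≡ ρ
    b2 = proj₂ (proj₂ (proj₂ (proj₂ T)))
    label = relabel i2 (suc ρ) (λ i → block (ds i))
    lower : ∀ t → t N.< ρ → ∃ λ i → label i ≡ t
    lower t t<ρ = it , P.trans (relabel-other i2 _ _ it it≢i2) bt
      where
      evens≠0 : ¬ (coord (sumEvensTop ρ) (2 N.* t) ≈ 0#)
      evens≠0 e = 1≉0 (trans (sym (trans (+-cong (reflexive (evens-< ρ t t<ρ)) (ev-oe ρ t)) (+-identityʳ 1#)))
                            (trans (sym (cx _ (even<NN ρ (NP.<⇒≤ t<ρ)))) e))
      found = point-in-block Dc t (NP.<⇒≤ t<ρ) evens≠0
      it = proj₁ found
      bt = proj₂ found
      it≢i2 : it ≢ i2
      it≢i2 e = NP.<⇒≢ t<ρ (P.trans (P.sym bt) (P.trans (P.cong (λ i → block (ds i)) e) b2))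
    hit : ∀ t → t N.< suc (suc ρ) → ∃ λ i → label i ≡ t
    hit t tl with split-last-two tl
    ... | inj₁ t<ρ = lower t t<ρ
    ... | inj₂ (inj₁ P.refl) = i1 , P.trans (relabel-other i2 _ _ i1 i1≢i2) b1
    ... | inj₂ (inj₂ P.refl) = i2 , relabel-same i2 _ _

-- Minimality: every point of S_ρ is needed.  The probe vector of a valid point
-- P can only be written with ρ+1 points of S_ρ if P itself is used.
module Rigidity {c ℓ} (R : CommutativeRing c ℓ) (isF : IsField R)
         (_≟_ : (x y : CommutativeRing.Carrier R) → Dec (CommutativeRing._≈_ R x y)) where
  open FieldAlgebra R isF _≟_
  open Descriptors R isF _≟_
  open PointsOfS R isF _≟_
  open BlockCounting R isF _≟_
  open Geometry R

  zero-odd-is-E : ∀ {ρ d u} → Valid ρ d → block d ≡ u → 1 N.≤ u → vecD d (suc (2 N.* u)) ≈ 0# → d ≡ E u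
  zero-odd-is-E (vP0 a) P.refl () z
  zero-odd-is-E {ρ} {Q (suc w) a} (vQ p a0) P.refl _ z = ⊥-elim (nz-* a0 a0 (trans (sym (Q-odd w a)) z))
  zero-odd-is-E (vE p) P.refl _ z = P.refl

  P0-cong : ∀ {a a'} → a' ≈ a → ∀ j → vecD (P0 a') j ≈ vecD (P0 a) j
  P0-cong e j = +-congˡ (*-congʳ e)

  Q-cong : ∀ {u a a'} → a' ≈ a → ∀ j → vecD (Q u a') j ≈ vecD (Q u a) j
  Q-cong e j = +-cong (+-congˡ (*-congʳ e)) (*-congʳ (*-cong e e))

  same-point : ∀ {ρ dv d'} c → Valid ρ dv → Valid ρ d' → block d' ≡ block dv →
               c * vecD d' (2 N.* block dv) ≈ vecD dv (2 N.* block dv) →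
               c * vecD d' (suc (2 N.* block dv)) ≈ vecD dv (suc (2 N.* block dv)) →
               ∀ j → vecD d' j ≈ vecD dv j
  same-point c (vP0 a) (vP0 a') P.refl even-match odd-match = P0-cong a'a
    where
    c1 : c ≈ 1#
    c1 = trans (sym (trans (*-congˡ (P0-first a')) (*-identityʳ c))) (trans even-match (P0-first a))
    a'a : a' ≈ a
    a'a = trans (sym (*-identityˡ a')) (trans (*-congʳ (sym c1)) (trans (*-congˡ (sym (P0-second a'))) (trans odd-match (P0-second a))))
  same-point {ρ} {Q (suc w) a} {Q (suc .w) a'} c (vQ p a0) (vQ p' a'0) P.refl even-match odd-match = Q-cong {suc w} a'a
    where
    ca : c * a' ≈ a
    ca = trans (*-congˡ (sym (Q-even w a'))) (trans even-match (Q-even w a))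
    caa : c * (a' * a') ≈ a * a
    caa = trans (*-congˡ (sym (Q-odd w a'))) (trans odd-match (Q-odd w a))
    a'a : a' ≈ a
    a'a = cancelˡ a0 (trans (*-congʳ (sym ca)) (trans (*-assoc c a' a') caa))
  same-point {ρ} {Q (suc w) a} {E (suc .w)} c (vQ p a0) (vE p') P.refl even-match odd-match =
    ⊥-elim (nz-* a0 a0 (trans (sym (Q-odd w a)) (trans (sym odd-match) (trans (*-congˡ (ev-eo (suc w) (suc w))) (zeroʳ c)))))
  same-point {ρ} {E (suc w)} {Q (suc .w) a'} c (vE p) (vQ p' a'0) P.refl even-match odd-match = ⊥-elim (1≉0 contra)
    where
    ca : c * a' ≈ 1#
    ca = trans (*-congˡ (sym (Q-even w a'))) (trans even-match (ev1 (2 N.* suc w)))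
    contra : 1# ≈ 0#
    contra with zero-prod (trans (*-congˡ (sym (Q-odd w a'))) (trans odd-match (ev-eo (suc w) (suc w))))
    ... | inj₁ c0 = trans (sym ca) (trans (*-congʳ c0) (zeroˡ a'))
    ... | inj₂ aa0 = ⊥-elim (nz-* a'0 a'0 aa0)
  same-point c (vE p) (vE p') P.refl even-match odd-match j = refl

  probeSeq : ℕ → D → ℕ → F
  probeSeq ρ dv n = vecD dv n + (evens (suc ρ) n - ev (2 N.* block dv) n)

  probe : ∀ ρ → D → Vect (NN ρ)
  probe ρ dv j = probeSeq ρ dv (toℕ j)

  probe-even-own : ∀ ρ {dv} → Valid ρ dv → probeSeq ρ dv (2 N.* block dv) ≈ vecD dv (2 N.* block dv)
  probe-even-own ρ {dv} vdv = trans (+-congˡ (+-cong (reflexive (evens-< (suc ρ) (block dv) (s≤s (block≤ vdv)))) (-‿cong (ev1 (2 N.* block dv)))))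
                                    (solve 1 (λ x → x :+ (:1 :- :1) := x) refl _)

  -- Rigidity: a combination of at most ρ+1 points of S_ρ equal to the probe of
  -- P has exactly one point in each block, none of them e_{2ρ+1}; above block w
  -- they are the points e_{2u}, and the one in block w is P itself.
  module Unique (ρ : ℕ) (dv : D) (vdv : Valid ρ dv) {m : ℕ} (Dc : Decomp ρ m (probe ρ dv))
            (k≤ρ+1 : Decomp.k Dc N.≤ suc ρ) where
    open Decomp Dc
    w = block dv
    wl : w N.≤ ρ
    wl = block≤ vdv

    coord-probe : ∀ n → n N.< NN ρ → coord (probe ρ dv) n ≈ probeSeq ρ dv n
    coord-probe n p = reflexive (coord-toVect ρ (probeSeq ρ dv) n p)

    probe-even-other : ∀ b → b N.≤ ρ → b ≢ w → probeSeq ρ dv (2 N.* b) ≈ 1#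
    probe-even-other b bl bw = trans (+-cong z (+-cong (reflexive (evens-< (suc ρ) b (s≤s bl))) (-‿cong (ev-ee w b (λ e → bw (P.sym e)))))) (solve 0 (:0 :+ (:1 :- :0) := :1) refl)
      where
      z : vecD dv (2 N.* b) ≈ 0#
      z = [ (λ x → x) , (λ e → ⊥-elim (bw (P.sym e))) ]′ (even-coord-zero-or-block b (inj₁ vdv))

    probe-odd : ∀ b → probeSeq ρ dv (suc (2 N.* b)) ≈ vecD dv (suc (2 N.* b))
    probe-odd b = trans (+-congˡ (+-cong (reflexive (evens-odd (suc ρ) b)) (-‿cong (ev-eo w b)))) (solve 1 (λ x → x :+ (:0 :- :0) := x) refl _)

    probe-even-nz : ∀ b → b N.≤ ρ → ¬ (coord (probe ρ dv) (2 N.* b) ≈ 0#)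
    probe-even-nz b bl e with b N.≟ w
    ... | yes P.refl = even-coord-own vdv (trans (sym (probe-even-own ρ vdv)) (trans (sym (coord-probe _ (even<NN ρ bl))) e))
    ... | no ne = 1≉0 (trans (sym (probe-even-other b bl ne)) (trans (sym (coord-probe _ (even<NN ρ bl))) e))

    -- each block has a point, since each even coordinate of the probe is nonzero
    pointOf : ∀ t → t N.≤ ρ → Fin k
    pointOf t p = proj₁ (point-in-block Dc t p (probe-even-nz t p))
    pointOf-block : ∀ t p → block (ds (pointOf t p)) ≡ t
    pointOf-block t p = proj₂ (point-in-block Dc t p (probe-even-nz t p))

    -- a point e_{2ρ+1} would be a (ρ+2)-nd point, one more than allowed
    all-valid : ∀ i → Valid ρ (ds i)
    all-valid i = [ (λ v → v) , (λ { (lift e) → ⊥-elim (NP.<⇒≱ (labels-attained (λ i → block (ds i)) (suc (suc ρ)) (h e)) k≤ρ+1) }) ]′ (valid i)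
      where
      h : ds i ≡ Top ρ → ∀ t → t N.< suc (suc ρ) → ∃ λ j → block (ds j) ≡ t
      h e t (s≤s tl) = [ (λ t<  → pointOf t (N.s≤s⁻¹ t<) , pointOf-block t (N.s≤s⁻¹ t<)) , (λ t≡ → i , P.trans (P.cong block e) (P.sym t≡)) ]′ (NP.m≤n⇒m<n∨m≡n tl)

    -- two points in the same block would also leave one block uncovered
    block-injective : ∀ i i' → block (ds i) ≡ block (ds i') → i ≡ i'
    block-injective i i' be with i Fin.≟ i'
    ... | yes e = e
    ... | no ne = ⊥-elim (NP.<⇒≱ (labels-attained key (suc (suc ρ)) h) k≤ρ+1)
      where
      key = relabel i' (suc ρ) (λ j → block (ds j))
      pick : ∀ t (p : t N.≤ ρ) → ∃ λ j → key j ≡ t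
      pick t p with pointOf t p Fin.≟ i'
      ... | yes e = i , P.trans (relabel-other i' _ _ i ne) (P.trans be (P.trans (P.cong (λ j → block (ds j)) (P.sym e)) (pointOf-block t p)))
      ... | no n' = pointOf t p , P.trans (relabel-other i' _ _ (pointOf t p) n') (pointOf-block t p)
      h : ∀ t → t N.< suc (suc ρ) → ∃ λ j → key j ≡ t
      h t (s≤s tl) = [ (λ t< → pick t (N.s≤s⁻¹ t<)) , (λ t≡ → i' , P.trans (relabel-same i' _ _) (P.sym t≡)) ]′ (NP.m≤n⇒m<n∨m≡n tl)

    even-coord-single : ∀ u (p : u N.≤ ρ) → coord (probe ρ dv) (2 N.* u) ≈ cs (pointOf u p) * vecD (ds (pointOf u p)) (2 N.* u)
    even-coord-single u p = trans (coord-sum _ (even<NN ρ p)) (sum-1 k (pointOf u p) oth)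
      where
      oth : ∀ i → i ≢ pointOf u p → cs i * vecD (ds i) (2 N.* u) ≈ 0#
      oth i ne = [ (λ z → trans (*-congˡ z) (zeroʳ _)) ,
                   (λ e → ⊥-elim (ne (block-injective i (pointOf u p) (P.trans e (P.sym (pointOf-block u p)))))) ]′
                 (even-coord-zero-or-block u (valid i))

    odd-coord-top : ∀ u (p : u N.≤ ρ) → u ≡ ρ → coord (probe ρ dv) (suc (2 N.* u)) ≈ cs (pointOf u p) * vecD (ds (pointOf u p)) (suc (2 N.* u))
    odd-coord-top u p uρ = trans (coord-sum _ (odd<NN ρ p)) (sum-1 k (pointOf u p) oth)
      where
      oth : ∀ i → i ≢ pointOf u p → cs i * vecD (ds i) (suc (2 N.* u)) ≈ 0#
      oth i ne = [ (λ z → trans (*-congˡ z) (zeroʳ _)) ,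
                   [ (λ e → ⊥-elim (ne (block-injective i (pointOf u p) (P.trans e (P.sym (pointOf-block u p)))))) ,
                     (λ e → ⊥-elim (NP.<-irrefl P.refl (P.subst (N._≤ ρ) (P.trans e (P.cong suc uρ)) (block≤ (all-valid i))))) ]′ ]′
                 (odd-coord-zero-or-block u (valid i))

    odd-coord-pair : ∀ u (p : u N.≤ ρ) (p' : suc u N.≤ ρ) → coord (probe ρ dv) (suc (2 N.* u)) ≈
            cs (pointOf u p) * vecD (ds (pointOf u p)) (suc (2 N.* u)) + cs (pointOf (suc u) p') * vecD (ds (pointOf (suc u) p')) (suc (2 N.* u))
    odd-coord-pair u p p' = trans (coord-sum _ (odd<NN ρ p)) (sum-2 k (pointOf u p) (pointOf (suc u) p') dis oth)
      where
      dis : pointOf u p ≢ pointOf (suc u) p'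
      dis e = NP.<⇒≢ (NP.n<1+n u) (P.trans (P.sym (pointOf-block u p)) (P.trans (P.cong (λ j → block (ds j)) e) (pointOf-block (suc u) p')))
      oth : ∀ i → i ≢ pointOf u p → i ≢ pointOf (suc u) p' → cs i * vecD (ds i) (suc (2 N.* u)) ≈ 0#
      oth i n1 n2 = [ (λ z → trans (*-congˡ z) (zeroʳ _)) ,
                   [ (λ e → ⊥-elim (n1 (block-injective i (pointOf u p) (P.trans e (P.sym (pointOf-block u p)))))) ,
                     (λ e → ⊥-elim (n2 (block-injective i (pointOf (suc u) p') (P.trans e (P.sym (pointOf-block (suc u) p')))))) ]′ ]′
                 (odd-coord-zero-or-block u (valid i))

    probe-even-coord : ∀ u (p : u N.≤ ρ) → u ≢ w → coord (probe ρ dv) (2 N.* u) ≈ 1#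
    probe-even-coord u p ne = trans (coord-probe _ (even<NN ρ p)) (probe-even-other u p ne)

    coeff-nz : ∀ u (p : u N.≤ ρ) → u ≢ w → ¬ (cs (pointOf u p) ≈ 0#)
    coeff-nz u p ne e = 1≉0 (trans (sym (probe-even-coord u p ne)) (trans (even-coord-single u p) (trans (*-congʳ e) (zeroˡ _))))

    -- downward from block ρ, the point of each block u > w is e_{2u}: the odd
    -- coordinate 2u+1 of the probe vanishes and the point of block u+1 (= e_{2u+2})
    -- does not contribute to it
    above-are-E : ∀ n u (p : u N.≤ ρ) → u N.+ n ≡ ρ → w N.< u → ds (pointOf u p) ≡ E u
    above-are-E n u p eq wu = zero-odd-is-E (all-valid (pointOf u p)) (pointOf-block u p) (NP.<-≤-trans (s≤s z≤n) wu) (own-odd-zero n eq)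
      where
      ne : u ≢ w
      ne e = NP.<⇒≢ wu (P.sym e)
      probe-odd-zero : coord (probe ρ dv) (suc (2 N.* u)) ≈ 0#
      probe-odd-zero = trans (coord-probe _ (odd<NN ρ p)) (trans (probe-odd u)
             ([ (λ z → z) , [ (λ e → ⊥-elim (ne (P.sym e))) , (λ e → ⊥-elim (NP.<-asym wu (P.subst (u N.<_) (P.sym e) (NP.n<1+n u)))) ]′ ]′
               (odd-coord-zero-or-block u (inj₁ vdv))))
      own-odd-zero : ∀ n → u N.+ n ≡ ρ → vecD (ds (pointOf u p)) (suc (2 N.* u)) ≈ 0#
      own-odd-zero zero eq = nz-factor (coeff-nz u p ne) (trans (sym (odd-coord-top u p (P.trans (P.sym (NP.+-identityʳ u)) eq))) probe-odd-zero)
      own-odd-zero (suc n') eq = nz-factor (coeff-nz u p ne) (trans (sym (+-identityʳ _)) (trans (+-congˡ (sym next-term-zero)) (trans (sym (odd-coord-pair u p p')) probe-odd-zero)))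
        where
        eq' : suc u N.+ n' ≡ ρ
        eq' = P.trans (P.sym (NP.+-suc u n')) eq
        p' : suc u N.≤ ρ
        p' = P.subst (suc u N.≤_) eq' (NP.m≤m+n (suc u) n')
        next-is-E : ds (pointOf (suc u) p') ≡ E (suc u)
        next-is-E = above-are-E n' (suc u) p' eq' (NP.<-trans wu (NP.n<1+n u))
        next-term-zero : cs (pointOf (suc u) p') * vecD (ds (pointOf (suc u) p')) (suc (2 N.* u)) ≈ 0#
        next-term-zero = trans (*-congˡ (trans (reflexive (P.cong (λ d → vecD d (suc (2 N.* u))) next-is-E)) (ev-eo (suc u) u))) (zeroʳ _)

    point-reappears : ∃ λ i → ∀ j → vecD (ds i) j ≈ vecD dv j
    point-reappears = i , same-point (cs i) vdv (all-valid i) (pointOf-block w wl) even-match odd-match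
      where
      i = pointOf w wl
      even-match : cs i * vecD (ds i) (2 N.* w) ≈ vecD dv (2 N.* w)
      even-match = trans (sym (even-coord-single w wl)) (trans (coord-probe _ (even<NN ρ wl)) (probe-even-own ρ vdv))
      probe-odd-w : coord (probe ρ dv) (suc (2 N.* w)) ≈ vecD dv (suc (2 N.* w))
      probe-odd-w = trans (coord-probe _ (odd<NN ρ wl)) (probe-odd w)
      odd-match : cs i * vecD (ds i) (suc (2 N.* w)) ≈ vecD dv (suc (2 N.* w))
      odd-match with NP.m≤n⇒m<n∨m≡n wl
      ... | inj₂ wρ = trans (sym (odd-coord-top w wl wρ)) probe-odd-w
      ... | inj₁ p' = trans (sym (+-identityʳ _)) (trans (+-congˡ (sym next-term-zero)) (trans (sym (odd-coord-pair w wl p')) probe-odd-w))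
        where
        next-is-E : ds (pointOf (suc w) p') ≡ E (suc w)
        next-is-E = above-are-E (ρ N.∸ suc w) (suc w) p' (NP.m+[n∸m]≡n p') (NP.n<1+n w)
        next-term-zero : cs (pointOf (suc w) p') * vecD (ds (pointOf (suc w) p')) (suc (2 N.* w)) ≈ 0#
        next-term-zero = trans (*-congˡ (trans (reflexive (P.cong (λ d → vecD d (suc (2 N.* w))) next-is-E)) (ev-eo (suc w) w))) (zeroʳ _)


module UpperBounds {c ℓ} (R : CommutativeRing c ℓ) (isF : IsField R)
         (_≟_ : (x y : CommutativeRing.Carrier R) → Dec (CommutativeRing._≈_ R x y))
         (q : ℕ) (LF : LargeField R q) where
  open FieldAlgebra R isF _≟_
  open Descriptors R isF _≟_
  open PointsOfS R isF _≟_
  open MembershipM R _≟_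
  open Moves R isF _≟_ q LF
  open Covering R isF _≟_ q LF
  open Parity
  open Geometry R

  N⊆M : ∀ ρ (v : Vect (NN ρ)) → Nρ ρ v → Mρ ρ v
  N⊆M ρ v (nz , ncov) with M? ρ (coord v)
  ... | yes m = lift m
  ... | no nm = ⊥-elim (ncov (cover⇒S⁻ ρ v (cover-outsideM ρ (coord v) nm)))

  -- Outside M_ρ this is the covering theorem; inside M_ρ, x - x_{2ρ+1} e_{2ρ+1}
  -- has zero top block and needs only ρ points, to which e_{2ρ+1} is added.
  S-covers : ∀ ρ → AllCombOfAtMost (suc ρ) (Sρ ρ)
  S-covers ρ A nz with M? ρ (coord A)
  ... | no nm = cover⇒S ρ A (cover-outsideM ρ (coord A) nm)
  ... | yes m = CombOfAtMost-mono {S = Sρ ρ} {A = A} len (comb⇒lincomb ρ (Sρ ρ) A (l ++ (z , Top ρ) ∷ []) mem cov)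
    where
    x = coord A
    z = x (suc (2 N.* ρ))
    T = M-elim ρ x m
    C = cover-zeroTop ρ (shift x ρ z) (trans (shift-even x ρ z) (proj₁ T)) (shift-clears x ρ)
          (NotMBelow-cong ρ x (shift x ρ z) (λ j jl → sym (shift-low x ρ z j jl)) (proj₂ (proj₂ T)))
    l = proj₁ C
    mem = AllP.++⁺ (All.map valid⇒S (proj₁ (proj₂ (proj₂ C)))) (top⇒S ρ ∷ [])
    len : length (l ++ (z , Top ρ) ∷ []) N.≤ suc ρ
    len = P.subst (N._≤ suc ρ) (P.sym (length-++ l)) (P.subst (N._≤ suc ρ) (NP.+-comm 1 (length l)) (s≤s (proj₁ (proj₂ C))))
    cov : ∀ j → j N.< 2 N.* suc ρ → x j ≈ comb (l ++ (z , Top ρ) ∷ []) j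
    cov j jl = begin
      x j ≈⟨ solve 3 (λ x s e → x := (x :- s :* e) :+ (s :* e :+ :0)) refl (x j) z (ev (suc (2 N.* ρ)) j) ⟩
      shift x ρ z j + (z * ev (suc (2 N.* ρ)) j + 0#) ≈⟨ +-cong (proj₂ (proj₂ (proj₂ C)) j jl) (+-congʳ (*-congˡ (reflexive (P.sym (vecTop ρ j))))) ⟩
      comb l j + comb ((z , Top ρ) ∷ []) j ≈⟨ sym (comb-++ l ((z , Top ρ) ∷ []) j) ⟩
      comb (l ++ (z , Top ρ) ∷ []) j ∎

  S⁻-covers : ∀ ρ → AllCombOfAtMost (suc (ρ N.+ 1)) (Sρ⁻ ρ)
  S⁻-covers ρ A nz = CombOfAtMost-mono {S = Sρ⁻ ρ} {A = A} (s≤s (NP.≤-reflexive (NP.+-comm 1 ρ)))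
                       (cover⇒S⁻ ρ A (cover-any ρ (coord A)))

  top-coord : ∀ ρ n → n N.< NN ρ → coord (vecV {NN ρ} (Top ρ)) n ≈ ev (suc (2 N.* ρ)) n
  top-coord ρ n p = reflexive (P.trans (coord-toVect ρ (vecD (Top ρ)) n p) (vecTop ρ n))

  top-odd≠0 : ∀ ρ → ¬ (coord (vecV {NN ρ} (Top ρ)) (suc (2 N.* ρ)) ≈ 0#)
  top-odd≠0 ρ e = 1≉0 (trans (sym (ev1 (suc (2 N.* ρ)))) (trans (sym (top-coord ρ _ (odd<NN ρ NP.≤-refl))) e))

  top-nonzero : ∀ ρ → NonZeroV (vecV {NN ρ} (Top ρ))
  top-nonzero ρ = fromℕ< p , λ e → top-odd≠0 ρ (trans (reflexive (coord-at (vecV (Top ρ)) _ p)) e)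
    where p = odd<NN ρ NP.≤-refl

  top∈M : ∀ ρ → Mseq ρ (coord (vecV {NN ρ} (Top ρ)))
  top∈M ρ = M-intro ρ _ (trans (top-coord ρ _ (even<NN ρ NP.≤-refl)) (ev-oe ρ ρ)) (top-odd≠0 ρ) (below ρ)
    where
    below : ∀ ρ → NotMBelow ρ (coord (vecV {NN ρ} (Top ρ)))
    below zero = lift tt
    below (suc r) m = proj₁ (proj₂ (M-elim r _ m))
      (trans (top-coord (suc r) _ (odd<NN (suc r) (NP.n≤1+n r))) (ev-oo (suc r) r (λ e → NP.<⇒≢ (NP.n<1+n r) (P.sym e))))

  -- for ρ = r + 2, e_{2ρ+1} is a sum of three points of block ρ (move-three)
  top-covered : ∀ r → Covered (suc (suc r)) (Sρ⁻ (suc (suc r))) (vecV (Top (suc (suc r))))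
  top-covered r = cover⇒S⁻ ρ (vecV (Top ρ)) (Cover-mono (s≤s (s≤s (s≤s z≤n))) (extend-by-move (suc r) x 0# nothing-below three))
    where
    ρ = suc (suc r)
    x = coord (vecV {NN ρ} (Top ρ))
    nothing-below : Cover (suc r) 0 (shift x (suc r) 0#)
    nothing-below = [] , z≤n , [] , λ j jl → begin
      x j - 0# * ev (suc (2 N.* suc r)) j ≈⟨ solve 2 (λ x e → x :- :0 :* e := x) refl (x j) _ ⟩
      x j ≈⟨ top-coord ρ j (P.subst (j N.<_) (P.sym (dim-eq ρ)) (NP.<-≤-trans jl (NP.*-monoʳ-≤ 2 (NP.n≤1+n (suc (suc r)))))) ⟩
      ev (suc (2 N.* ρ)) j ≈⟨ ev0< (NP.<-trans jl (NP.n<1+n _)) ⟩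
      0# ∎
    three : Move (suc r) 3 0# (x (2 N.* ρ)) (x (suc (2 N.* ρ)))
    three = Move≈ refl (sym (proj₁ (M-elim ρ x (top∈M ρ)))) refl (move-three (suc r) _ (top-odd≠0 ρ))

module LowerBounds {c ℓ} (R : CommutativeRing c ℓ) (isF : IsField R)
         (_≟_ : (x y : CommutativeRing.Carrier R) → Dec (CommutativeRing._≈_ R x y)) where
  open FieldAlgebra R isF _≟_
  open Descriptors R isF _≟_
  open PointsOfS R isF _≟_
  open BlockCounting R isF _≟_
  open Rigidity R isF _≟_
  open Geometry R

  sumEvensTop-not-covered : ∀ ρ m → m N.≤ suc ρ → (S : PointSet (NN ρ)) → (sub : ∀ v → S v → Sρ ρ v) →
         (∀ w → S w → ¬ (w ≈ᵥ vecV (Top ρ))) → ¬ CombOfAtMost m S (sumEvensTop ρ)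
  sumEvensTop-not-covered ρ m m≤ S sub nt C@(k , k≤m , _) =
    NP.<⇒≱ (sumEvensTop-needs ρ (decompose ρ m S (sumEvensTop ρ) sub C) (decompose-valid ρ m S (sumEvensTop ρ) sub nt C)) (NP.≤-trans k≤m m≤)

  sumEvensTop-nonzero : ∀ ρ → NonZeroV (sumEvensTop ρ)
  sumEvensTop-nonzero ρ = fromℕ< p , λ e → 1≉0 (trans (sym top1) (trans (sym (reflexive (P.cong (evensTop ρ) (FP.toℕ-fromℕ< p)))) e))
    where
    p = odd<NN ρ NP.≤-refl
    top1 : evensTop ρ (suc (2 N.* ρ)) ≈ 1#
    top1 = trans (+-cong (reflexive (evens-odd ρ ρ)) (ev1 (suc (2 N.* ρ)))) (+-identityˡ 1#)

  sumEvens-nonzero : ∀ ρ → NonZeroV (sumEvens ρ)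
  sumEvens-nonzero ρ = fromℕ< p , λ e → 1≉0 (trans (sym (reflexive (P.cong (evens (suc ρ)) (FP.toℕ-fromℕ< p)))) e)
    where p = even<NN ρ {0} z≤n

  S-not-fewer : ∀ ρ → ¬ AllCombOfAtMost ρ (Sρ ρ)
  S-not-fewer ρ H = NP.<⇒≱ (sumEvens-needs ρ (decompose ρ ρ (Sρ ρ) (sumEvens ρ) (λ v x → x) C)) (proj₁ (proj₂ C))
    where C = H (sumEvens ρ) (sumEvens-nonzero ρ)

  S⁻-not-fewer : ∀ ρ → ¬ AllCombOfAtMost (ρ N.+ 1) (Sρ⁻ ρ)
  S⁻-not-fewer ρ H = sumEvensTop-not-covered ρ (ρ N.+ 1) (NP.≤-reflexive (NP.+-comm ρ 1)) (Sρ⁻ ρ) (λ w → proj₁) (λ w → proj₂)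
                       (H (sumEvensTop ρ) (sumEvensTop-nonzero ρ))

  -- Removing a point P from S_ρ destroys ρ-saturation: for P = e_{2ρ+1} the
  -- vector Σ_{u<ρ} e_{2u} + e_{2ρ+1} is lost, otherwise the probe vector of P.
  S-minimal : ∀ ρ (T : PointSet (NN ρ)) → T ⊂ₚ Sρ ρ → ¬ Saturating ρ T
  S-minimal ρ T (sub , v , Sv , nzv , noP) (allT , _) with describe Sv
  ... | dv , inj₂ (lift P.refl) , veq = sumEvensTop-not-covered ρ (suc ρ) NP.≤-refl T sub not-top (allT (sumEvensTop ρ) (sumEvensTop-nonzero ρ))
    where
    not-top : ∀ w → T w → ¬ (w ≈ᵥ vecV (Top ρ))
    not-top w Tw weq = noP w Tw (1# , λ j → trans (weq j) (trans (sym (veq j)) (sym (*-identityˡ _))))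
  ... | dv , inj₁ vdv , veq = noP (ps i) (mem i) (1# , λ j → trans (Decomp.points≈ Dc i j) (trans (same (toℕ j)) (trans (sym (veq j)) (sym (*-identityˡ _)))))
    where
    p = even<NN ρ (block≤ vdv)
    probe≠0 : NonZeroV (probe ρ dv)
    probe≠0 = fromℕ< p , λ e → even-coord-own vdv (trans (sym (probe-even-own ρ vdv)) (trans (sym (reflexive (P.cong (probeSeq ρ dv) (FP.toℕ-fromℕ< p)))) e))
    C = allT (probe ρ dv) probe≠0
    ps = proj₁ (proj₂ (proj₂ (proj₂ C)))
    mem = proj₁ (proj₂ (proj₂ (proj₂ (proj₂ C))))
    Dc = decompose ρ (suc ρ) T (probe ρ dv) sub C
    i = proj₁ (Unique.point-reappears ρ dv vdv Dc (proj₁ (proj₂ C)))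
    same = proj₂ (Unique.point-reappears ρ dv vdv Dc (proj₁ (proj₂ C)))

  fin≤1 : ∀ {k} → k N.≤ 1 → (i j : Fin k) → i ≡ j
  fin≤1 (s≤s z≤n) Fin.zero Fin.zero = P.refl

  -- ρ = 0: a point (0, x₁) of M₀ would need two points of block 0, but only one is allowed
  M0-not-covered : ∀ (v : Vect (NN 0)) → Mseq 0 (coord v) → ¬ Covered 0 (Sρ⁻ 0) v
  M0-not-covered v m C = proj₁ (proj₂ (proj₂ T)) (fin≤1 (proj₁ (proj₂ C)) _ _)
    where
    Dc = decompose 0 1 (Sρ⁻ 0) v (λ w → proj₁) C
    T = two-points-in-top-block Dc (decompose-valid 0 1 (Sρ⁻ 0) v (λ w → proj₁) (λ w → proj₂) C) (proj₁ m) (proj₂ m)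

  no-three-distinct : ∀ {k} → k N.≤ 2 → (i1 i2 i : Fin k) → i1 ≢ i2 → i ≢ i1 → i ≢ i2 → ⊥
  no-three-distinct {k} kl i1 i2 i n12 n1 n2 = NP.<⇒≱ (labels-attained label 3 hit) kl
    where
    label = relabel i1 0 (relabel i2 1 (λ _ → 2))
    hit : ∀ t → t N.< 3 → ∃ λ j → label j ≡ t
    hit zero _ = i1 , relabel-same i1 _ _
    hit (suc zero) _ = i2 , P.trans (relabel-other i1 _ _ i2 (λ e → n12 (P.sym e))) (relabel-same i2 _ _)
    hit (suc (suc zero)) _ = i , P.trans (relabel-other i1 _ _ i n1) (relabel-other i2 _ _ i n2)
    hit (suc (suc (suc t))) (s≤s (s≤s (s≤s ())))

  block1-pair : ∀ {d1 d2} c1 c2 → Valid 1 d1 → Valid 1 d2 → block d1 ≡ 1 → block d2 ≡ 1 →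
         c1 * vecD d1 1 + c2 * vecD d2 1 ≈ 0# → c1 * vecD d1 2 + c2 * vecD d2 2 ≈ 0# →
         ¬ (c1 * vecD d1 3 + c2 * vecD d2 3 ≈ 0#) → ⊥
  block1-pair {Q 1 a} {Q 1 b} c1 c2 (vQ (s≤s z≤n) a0) (vQ (s≤s z≤n) b0) P.refl P.refl e1 e2 n3 =
    [ (λ c0 → n3 (begin
        c1 * vecD (Q 1 a) 3 + c2 * vecD (Q 1 b) 3 ≈⟨ +-cong (*-congˡ (Q-odd 0 a)) (*-congˡ (Q-odd 0 b)) ⟩
        c1 * (a * a) + c2 * (b * b) ≈⟨ +-cong (trans (*-congʳ c0) (zeroˡ _)) (trans (*-congʳ (c2≈-c1 c0)) (zeroˡ _)) ⟩
        0# + 0# ≈⟨ +-identityʳ 0# ⟩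
        0# ∎)) ,
      (λ a-b≈0 → n3 (begin
        c1 * vecD (Q 1 a) 3 + c2 * vecD (Q 1 b) 3
          ≈⟨ +-cong (*-congˡ (Q-odd 0 a)) (*-congˡ (trans (Q-odd 0 b) (*-cong (sym (diff0 a-b≈0)) (sym (diff0 a-b≈0))))) ⟩
        c1 * (a * a) + c2 * (a * a) ≈⟨ sym (distribʳ (a * a) c1 c2) ⟩
        (c1 + c2) * (a * a) ≈⟨ *-congʳ c1+c2≈0 ⟩
        0# * (a * a) ≈⟨ zeroˡ _ ⟩
        0# ∎)) ]′ (zero-prod c1[a-b]≈0)
    where
    c1+c2≈0 : c1 + c2 ≈ 0#
    c1+c2≈0 = trans (sym (+-cong (trans (*-congˡ (Q-side 0 a)) (*-identityʳ c1)) (trans (*-congˡ (Q-side 0 b)) (*-identityʳ c2)))) e1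
    c1a+c2b≈0 : c1 * a + c2 * b ≈ 0#
    c1a+c2b≈0 = trans (sym (+-cong (*-congˡ (Q-even 0 a)) (*-congˡ (Q-even 0 b)))) e2
    c1[a-b]≈0 : c1 * (a - b) ≈ 0#
    c1[a-b]≈0 = begin
      c1 * (a - b) ≈⟨ solve 4 (λ c1 c2 a b → c1 :* (a :- b) := (c1 :* a :+ c2 :* b) :- (c1 :+ c2) :* b) refl c1 c2 a b ⟩
      (c1 * a + c2 * b) - (c1 + c2) * b ≈⟨ +-cong c1a+c2b≈0 (-‿cong (*-congʳ c1+c2≈0)) ⟩
      0# - 0# * b ≈⟨ solve 1 (λ b → :0 :- :0 :* b := :0) refl b ⟩
      0# ∎
    c2≈-c1 : c1 ≈ 0# → c2 ≈ 0#
    c2≈-c1 c0 = trans (sym (+-identityˡ c2)) (trans (+-congʳ (sym c0)) c1+c2≈0)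
  block1-pair {Q 1 a} {E 1} c1 c2 (vQ (s≤s z≤n) a0) (vE (s≤s z≤n)) P.refl P.refl e1 e2 n3 =
    n3 (trans (+-cong (trans (*-congʳ c0) (zeroˡ _)) (trans (*-congˡ (ev-eo 1 1)) (zeroʳ c2))) (+-identityʳ 0#))
    where
    c0 : c1 ≈ 0#
    c0 = trans (sym (trans (+-cong (trans (*-congˡ (Q-side 0 a)) (*-identityʳ c1)) (trans (*-congˡ (ev-eo 1 0)) (zeroʳ c2))) (+-identityʳ c1))) e1
  block1-pair {E 1} {Q 1 b} c1 c2 (vE (s≤s z≤n)) (vQ (s≤s z≤n) b0) P.refl P.refl e1 e2 n3 =
    n3 (trans (+-cong (trans (*-congˡ (ev-eo 1 1)) (zeroʳ c1)) (trans (*-congʳ c0) (zeroˡ _))) (+-identityʳ 0#))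
    where
    c0 : c2 ≈ 0#
    c0 = trans (sym (trans (+-cong (trans (*-congˡ (ev-eo 1 0)) (zeroʳ c1)) (trans (*-congˡ (Q-side 0 b)) (*-identityʳ c2))) (+-identityˡ c2))) e1
  block1-pair {E 1} {E 1} c1 c2 (vE (s≤s z≤n)) (vE (s≤s z≤n)) P.refl P.refl e1 e2 n3 =
    n3 (trans (+-cong (trans (*-congˡ (ev-eo 1 1)) (zeroʳ c1)) (trans (*-congˡ (ev-eo 1 1)) (zeroʳ c2))) (+-identityʳ 0#))

  -- ρ = 1: a point of M₁ needs two points of block 1 (for x₂ = 0, x₃ ≠ 0), hence
  -- nothing in block 0, so x₀ = 0 and (as x ∉ M₀) x₁ = 0 — impossible by block1-pair
  M1-not-covered : ∀ (v : Vect (NN 1)) → Mseq 1 (coord v) → ¬ Covered 1 (Sρ⁻ 1) v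
  M1-not-covered v (nm0 , y0 , z3) C = block1-pair (cs i1) (cs i2) (vl i1) (vl i2) bk1 bk2 eq1 eq2 n3
    where
    Dc = decompose 1 2 (Sρ⁻ 1) v (λ w → proj₁) C
    open Decomp Dc
    vl = decompose-valid 1 2 (Sρ⁻ 1) v (λ w → proj₁) (λ w → proj₂) C
    T = two-points-in-top-block Dc vl y0 z3
    i1 = proj₁ T
    i2 = proj₁ (proj₂ T)
    n12 = proj₁ (proj₂ (proj₂ T))
    bk1 = proj₁ (proj₂ (proj₂ (proj₂ T)))
    bk2 = proj₂ (proj₂ (proj₂ (proj₂ T)))
    x = coord v
    two-terms : ∀ j (p : j N.< 4) → x j ≈ cs i1 * vecD (ds i1) j + cs i2 * vecD (ds i2) j
    two-terms j p = trans (coord-sum j p) (sum-2 k i1 i2 n12 (λ i a b → ⊥-elim (no-three-distinct k≤m i1 i2 i n12 a b)))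
    all-in-block1 : ∀ i → block (ds i) ≡ 1
    all-in-block1 i with i Fin.≟ i1 | i Fin.≟ i2
    ... | yes P.refl | _ = bk1
    ... | no _ | yes P.refl = bk2
    ... | no a | no b = ⊥-elim (no-three-distinct k≤m i1 i2 i n12 a b)
    x0 : x 0 ≈ 0#
    x0 = trans (coord-sum 0 (s≤s z≤n)) (sum-0 k (λ i → [ (λ z → trans (*-congˡ z) (zeroʳ _)) ,
                                                         (λ e → ⊥-elim (0≢1 (P.trans (P.sym e) (all-in-block1 i)))) ]′
                                                       (even-coord-zero-or-block 0 (valid i))))
      where
      0≢1 : 0 ≢ 1
      0≢1 ()
    x1 : x 1 ≈ 0#
    x1 with x 1 ≟ 0#
    ... | yes e = e
    ... | no ne = ⊥-elim (nm0 (x0 , ne))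
    eq1 = trans (sym (two-terms 1 (s≤s (s≤s z≤n)))) x1
    eq2 = trans (sym (two-terms 2 (s≤s (s≤s (s≤s z≤n))))) y0
    n3 = λ e → z3 (trans (two-terms 3 (s≤s (s≤s (s≤s (s≤s z≤n))))) e)

module Theorem {c ℓ} (R : CommutativeRing c ℓ) (isF : IsField R)
         (_≟_ : (x y : CommutativeRing.Carrier R) → Dec (CommutativeRing._≈_ R x y))
         (q : ℕ) (LF : LargeField R q) where
  open Descriptors R isF _≟_ using (Top)
  open PointsOfS R isF _≟_ using (vecV)
  open UpperBounds R isF _≟_ q LF
  open LowerBounds R isF _≟_
  open Geometry R

  S-minimal-saturating : ∀ ρ → MinimalSaturating ρ (Sρ ρ)
  S-minimal-saturating ρ = (S-covers ρ , S-not-fewer ρ) , S-minimal ρ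

  N₀≐M₀ : Nρ 0 ≐ₚ Mρ 0
  N₀≐M₀ v nz = N⊆M 0 v , λ { (lift m) → nz , M0-not-covered v m }

  N₁≐M₁ : Nρ 1 ≐ₚ Mρ 1
  N₁≐M₁ v nz = N⊆M 1 v , λ { (lift m) → nz , M1-not-covered v m }

  N⊊M : ∀ ρ → 2 N.≤ ρ → Nρ ρ ⊊ₚ Mρ ρ
  N⊊M (suc (suc r)) (s≤s (s≤s _)) =
    (λ v _ → N⊆M ρ v) , vecV (Top ρ) , top-nonzero ρ , lift (top∈M ρ) ,
    λ { (_ , not-covered) → not-covered (top-covered r) }
    where ρ = suc (suc r)

  S⁻-saturating : ∀ ρ → Saturating (ρ N.+ 1) (Sρ⁻ ρ)
  S⁻-saturating ρ = S⁻-covers ρ , S⁻-not-fewer ρ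

largeField : ∀ {c ℓ} (q : ℕ) (R : CommutativeRing c ℓ) → IsField R → HasCard R q → (q ≡ 4 ⊎ 7 N.≤ q) → LargeField R q
largeField q R isF card qc = record
  { avoid = avoid
  ; 4≤q = [ (λ e → NP.≤-reflexive (P.sym e)) , NP.≤-trans (s≤s (s≤s (s≤s (s≤s z≤n)))) ]′ qc
  ; square? = square?
  ; all-squares-or-7≤q = Data.Sum.map₁ (FourElements.every-square isF) qc
  }
  where open FiniteRing R q card

open import Data.Nat using (_≤_; _+_)

theorem3p1 : ∀ {c ℓ} (q : ℕ) (R : CommutativeRing c ℓ) → IsField R → HasCard R q →
    (q ≡ 4 ⊎ 7 ≤ q) → (ρ : ℕ) →
    let open Geometry R in
      MinimalSaturating ρ (Sρ ρ)
      × ((Nρ 0 ≐ₚ Mρ 0) × (Nρ 1 ≐ₚ Mρ 1) × (2 ≤ ρ → Nρ ρ ⊊ₚ Mρ ρ))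
      × Saturating (ρ + 1) (Sρ⁻ ρ)
theorem3p1 q R isF card qc ρ =
  S-minimal-saturating ρ , (N₀≐M₀ , N₁≐M₁ , N⊊M ρ) , S⁻-saturating ρ
  where
  open FiniteRing R q card using (_≟_)
  open Theorem R isF _≟_ q (largeField q R isF card qc)
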